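{- Two locally convex broken lines with integer vertices (or two locally convex polygons with integer vertices) are integer congruent if and only if their angle-curvature sequences coincide and their sequences of integer lengths of edges coincide.
   Context: Integer congruence: existence of an affine map of $\mathbb R^2$ preserving $\mathbb Z^2$ mapping one onto the other (respecting the order of vertices). A broken line $A_0A_1\ldots A_{n+1}$ with integer vertices is locally convex if all angles $\angle A_{i-1}A_iA_{i+1}$ are simultaneously positively oriented or simultaneously negatively oriented (sign of $\det(A_iA_{i-1},A_iA_{i+1})$, nonzero); for a polygon $A_1\ldots A_n$ indices are mod $n$. Integer length $\ell(AB)$: number of connected components of $AB\setminus\mathbb Z^2$. Integer distance from an integer point $P$ to an integer line $L$: index in $\mathbb Z^2$ of the sublattice generated by integer vectors from $P$ to integer points of $L$. Chord curvature: $\varkappa(ABCD)=\ell(BC)-\mathrm{sgn}\langle BC,B'C'\rangle\,\ell(B'C')-2$, with $B'$ the integer point of angle $\angle ABC$ at unit integer distance from line $BC$ closest to line $AB$, $C'$ the integer point of angle $\angle BCD$ at unit integer distance from line $BC$ closest to line $CD$, and the sign $1,0,-1$ according as $B'C'$ has the same direction as $BC$, $B'=C'$, or opposite direction. Angle-curvature sequence of the broken line $A_0\ldots A_{n+1}$: $(\alpha_1,\varkappa_1,\ldots,\alpha_{n-1},\varkappa_{n-1},\alpha_n)$, where $\alpha_i$ is the integer congruence class of the angle $\angle A_{i-1}A_iA_{i+1}$ and $\varkappa_i=\varkappa(A_{i-1}A_iA_{i+1}A_{i+2})$. For a polygon $A_1\ldots A_n$: $(\alpha_1,\varkappa_1,\ldots,\alpha_n,\varkappa_n)$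 with indices mod $n$. -}

module Defs where

open import Data.Nat using (ℕ; zero; suc; NonZero) renaming (_≤_ to _≤ℕ_; _<_ to _<ℕ_; _+_ to _+ℕ_)
open import Data.Nat.DivMod using (_%_; m%n<n)
import Data.Nat as ℕ
open import Data.Nat.GCD using (gcd)
open import Data.Integer using (ℤ; +_; -[1+_]; -_; _+_; _-_; _*_; _<_; _>_; ∣_∣; 0ℤ; 1ℤ; -1ℤ)
open import Data.Fin using (Fin; fromℕ<)
open import Data.Product using (Σ; ∃; ∃-syntax; _×_; _,_)
open import Data.Sum using (_⊎_)
open import Relation.Binary.PropositionalEquality using (_≡_)

Point : Set
Point = ℤ × ℤ

vec : Point → Point → ℤ × ℤ
vec (x₁ , y₁) (x₂ , y₂) = (x₂ - x₁ , y₂ - y₁)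

det : ℤ × ℤ → ℤ × ℤ → ℤ
det (a , b) (c , d) = a * d - b * c

dot : ℤ × ℤ → ℤ × ℤ → ℤ
dot (a , b) (c , d) = a * c + b * d

_·ᵥ_ : ℤ → ℤ × ℤ → ℤ × ℤ
k ·ᵥ (a , b) = (k * a , k * b)

_+ᵥ_ : ℤ × ℤ → ℤ × ℤ → ℤ × ℤ
(a , b) +ᵥ (c , d) = (a + c , b + d)

-- Affine maps of ℝ² preserving ℤ²: x ↦ M x + t with M ∈ GL(2,ℤ), t ∈ ℤ².

record IntAffine : Set where
  field
    a b c d e f : ℤ
    unimodular : (a * d - b * c ≡ 1ℤ) ⊎ (a * d - b * c ≡ -1ℤ)

apply : IntAffine → Point → Point
apply g (x , y) = (a * x + b * y + e , c * x + d * y + f)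
  where open IntAffine g

-- Integer length: ℓ(AB) = number of components of AB ∖ ℤ² = gcd(|Δx|,|Δy|)
-- (0 when A = B).

intLength : Point → Point → ℕ
intLength A B with vec A B
... | (dx , dy) = gcd ∣ dx ∣ ∣ dy ∣

-- Integer distance from an integer point X to the integer line through
-- the distinct integer points B, C:  |det(BC, BX)| / ℓ(BC)
-- (the index of the sublattice generated by the vectors from X to the
-- integer points of the line).
intDist : Point → Point → Point → ℕ
intDist X B C with intLength B C
... | zero  = zero
... | suc k = ℕ._/_ ∣ det (vec B C) (vec B X) ∣ (suc k)

SameDir : ℤ × ℤ → ℤ × ℤ → Set
SameDir u w = Σ ℕ λ p → Σ ℕ λ q →
  (0 ℕ.< p) × (0 ℕ.< q) × ((+ p) ·ᵥ u ≡ (+ q) ·ᵥ w)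

AngleCong : Point → Point → Point → Point → Point → Point → Set
AngleCong A B C A' B' C' = Σ IntAffine λ g →
  (apply g B ≡ B') ×
  SameDir (vec (apply g B) (apply g A)) (vec B' A') ×
  SameDir (vec (apply g B) (apply g C)) (vec B' C')

-- The integer point X lies in the (closed) angle ∠ABC with vertex B:
-- BX = s·BA + t·BC with s, t ≥ 0 (necessarily rational).
InAngle : Point → Point → Point → Point → Set
InAngle A B C X = Σ ℕ λ p → Σ ℕ λ q → Σ ℕ λ r →
  (0 ℕ.< r) × ((+ r) ·ᵥ vec B X ≡ ((+ p) ·ᵥ vec B A) +ᵥ ((+ q) ·ᵥ vec B C))

IsBPrime : Point → Point → Point → Point → Set
IsBPrime A B C X =
  InAngle A B C X × (intDist X B C ≡ 1) ×
  ((Y : Point) → InAngle A B C Y → intDist Y B C ≡ 1 →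
     intDist X B A ≤ℕ intDist Y B A)

IsCPrime : Point → Point → Point → Point → Set
IsCPrime B C D X =
  InAngle B C D X × (intDist X B C ≡ 1) ×
  ((Y : Point) → InAngle B C D Y → intDist Y B C ≡ 1 →
     intDist X C D ≤ℕ intDist Y C D)

sgnDot : ℤ × ℤ → ℤ × ℤ → ℤ
sgnDot u w with dot u w
... | + zero    = 0ℤ
... | + suc _   = 1ℤ
... | -[1+ _ ] = -1ℤ

ChordCurv : Point → Point → Point → Point → ℤ → Set
ChordCurv A B C D k = Σ Point λ B' → Σ Point λ C' →
  IsBPrime A B C B' × IsCPrime B C D C' ×
  (k ≡ (+ intLength B C) - sgnDot (vec B C) (vec B' C') * (+ intLength B' C') - + 2)

-- Broken lines A₀ A₁ … A_{n+1}: given as A : ℕ → Point, only the values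
-- at 0 … n+1 are relevant.

BrokenLine : Set
BrokenLine = ℕ → Point

orient : Point → Point → Point → ℤ
orient P Q R = det (vec Q P) (vec Q R)

LocallyConvexBL : ℕ → BrokenLine → Set
LocallyConvexBL n A =
  ((i : ℕ) → 1 ≤ℕ i → i ≤ℕ n → orient (A (ℕ.pred i)) (A i) (A (suc i)) > 0ℤ)
  ⊎ ((i : ℕ) → 1 ≤ℕ i → i ≤ℕ n → orient (A (ℕ.pred i)) (A i) (A (suc i)) < 0ℤ)

IntCongruentBL : ℕ → BrokenLine → BrokenLine → Set
IntCongruentBL n A A' = Σ IntAffine λ g →
  (i : ℕ) → i ≤ℕ n +ℕ 1 → apply g (A i) ≡ A' i

SameAngleCurvBL : ℕ → BrokenLine → BrokenLine → Set
SameAngleCurvBL n A A' =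
  ((i : ℕ) → 1 ≤ℕ i → i ≤ℕ n →
     AngleCong (A (ℕ.pred i)) (A i) (A (suc i))
               (A' (ℕ.pred i)) (A' i) (A' (suc i))) ×
  ((i : ℕ) → 1 ≤ℕ i → i ≤ℕ ℕ.pred n → Σ ℤ λ k →
     ChordCurv (A (ℕ.pred i)) (A i) (A (suc i)) (A (suc (suc i))) k ×
     ChordCurv (A' (ℕ.pred i)) (A' i) (A' (suc i)) (A' (suc (suc i))) k)

SameLengthsBL : ℕ → BrokenLine → BrokenLine → Set
SameLengthsBL n A A' =
  (i : ℕ) → i ≤ℕ n → intLength (A i) (A (suc i)) ≡ intLength (A' i) (A' (suc i))

-- Polygons A₁ … A_n (indices mod n), given as Fin n → Point.

Polygon : ℕ → Set
Polygon n = Fin n → Point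

at : {n : ℕ} → .{{_ : NonZero n}} → Polygon n → ℕ → Point
at {n} P k = P (fromℕ< (m%n<n k n))

-- In the following, index i (0 ≤ i < n) stands for the vertex A_{i+1}
-- with neighbours A_i and A_{i+2} (all mod n); this runs over all vertices.

LocallyConvexPoly : (n : ℕ) → .{{_ : NonZero n}} → Polygon n → Set
LocallyConvexPoly n P =
  ((i : ℕ) → i ℕ.< n → orient (at P i) (at P (suc i)) (at P (suc (suc i))) > 0ℤ)
  ⊎ ((i : ℕ) → i ℕ.< n → orient (at P i) (at P (suc i)) (at P (suc (suc i))) < 0ℤ)

IntCongruentPoly : (n : ℕ) → Polygon n → Polygon n → Set
IntCongruentPoly n P P' = Σ IntAffine λ g → (i : Fin n) → apply g (P i) ≡ P' i

-- (α₁, κ₁, …, α_n, κ_n) with α_{i+1} = class of ∠A_i A_{i+1} A_{i+2},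
-- κ_{i+1} = κ(A_i A_{i+1} A_{i+2} A_{i+3})
SameAngleCurvPoly : (n : ℕ) → .{{_ : NonZero n}} → Polygon n → Polygon n → Set
SameAngleCurvPoly n P P' =
  ((i : ℕ) → i ℕ.< n →
     AngleCong (at P i) (at P (suc i)) (at P (suc (suc i)))
               (at P' i) (at P' (suc i)) (at P' (suc (suc i)))) ×
  ((i : ℕ) → i ℕ.< n → Σ ℤ λ k →
     ChordCurv (at P i) (at P (suc i)) (at P (suc (suc i))) (at P (suc (suc (suc i)))) k ×
     ChordCurv (at P' i) (at P' (suc i)) (at P' (suc (suc i))) (at P' (suc (suc (suc i)))) k)

SameLengthsPoly : (n : ℕ) → .{{_ : NonZero n}} → Polygon n → Polygon n → Set
SameLengthsPoly n P P' =
  (i : ℕ) → i ℕ.< n → intLength (at P i) (at P (suc i)) ≡ intLength (at P' i) (at P' (suc i))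

module Submission where

-- An integer congruence preserves integer lengths and distances, hence the angle classes, the points B′
-- and C′ and the chord curvatures. Conversely, the angle at A₁ and the lengths of its sides give a
-- congruence g of A₀A₁A₂ onto A′₀A′₁A′₂, and g carries over from A_{i-1}A_iA_{i+1} to A_{i+2}: the
-- congruence h of the angles at A_{i+1} sends A_i, A_{i+1}, A_{i+2} to their counterparts. Moving the
-- angle at A_i to standard position, B′ and C′ lie on one line parallel to A_iA_{i+1} at unit distance,
-- so the chord curvature fixes the signed length of B′C′, and g(C′) is the corresponding C′ of the
-- second line, as is h(C′). Agreeing on the non-collinear A_i, A_{i+1}, C′, the maps g and h coincide.

open import Defs
open import Data.Nat as ℕ using (ℕ; zero; suc; NonZero; z≤n; s≤s; pred; _≤_; _<_)
import Data.Nat.Properties as ℕP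
import Data.Nat.DivMod as ℕDM
open ℕDM using (_%_)
import Data.Nat.Divisibility as ℕD
open import Data.Nat.GCD using (gcd; gcd-GCD; module Bézout; gcd[m,n]∣m; gcd[m,n]∣n; gcd-greatest;
  gcd[m,n]≡0⇒m≡0; gcd[m,n]≡0⇒n≡0; c*gcd[m,n]≡gcd[cm,cn]; gcd-identityʳ)
open import Data.Integer using (ℤ; +_; -[1+_]; +[1+_]; +0; -_; _+_; _-_; _*_; ∣_∣;
  0ℤ; 1ℤ; -1ℤ; +<+; +≤+; NonNegative; nonNegative; ≢-nonZero) renaming (_≤_ to _≤ℤ_; _<_ to _<ℤ_; _>_ to _>ℤ_)
import Data.Integer.Properties as ℤP
import Data.Integer.DivMod as ℤDM
import Data.Integer.Divisibility.Signed as ℤD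
open import Data.Integer.Tactic.RingSolver using (solve-∀; solve)
open import Data.List using ([]; _∷_)
open import Data.Fin using (toℕ)
open import Data.Fin.Properties using (fromℕ<-cong; fromℕ<-toℕ; toℕ<n)
open import Data.Product using (Σ; _×_; _,_; proj₁; proj₂)
open import Data.Sum using (_⊎_; inj₁; inj₂)
open import Data.Empty using (⊥-elim)
open import Relation.Nullary using (¬_; yes; no)
open import Relation.Binary.PropositionalEquality
open import Function.Base using (_∘_)
open import Function.Bundles using (_⇔_; mk⇔)

Vector : Set
Vector = ℤ × ℤ

subst₃ : (P : Point → Point → Point → Set) {a a′ b b′ c c′ : Point} →
         a ≡ a′ → b ≡ b′ → c ≡ c′ → P a b c → P a′ b′ c′
subst₃ P refl refl refl p = p

linear : IntAffine → Vector → Vector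
linear g (x , y) = (a * x + b * y , c * x + d * y) where open IntAffine g

linearDet : IntAffine → ℤ
linearDet g = a * d - b * c where open IntAffine g

IsUnit : ℤ → Set
IsUnit z = (z ≡ 1ℤ) ⊎ (z ≡ -1ℤ)

unit≢0 : ∀ {z} → IsUnit z → ¬ z ≡ 0ℤ
unit≢0 (inj₁ refl) ()
unit≢0 (inj₂ refl) ()

linearDet-unit : ∀ g → IsUnit (linearDet g)
linearDet-unit = IntAffine.unimodular

unit*i≡0⇒i≡0 : ∀ {z} → IsUnit z → ∀ i → z * i ≡ 0ℤ → i ≡ 0ℤ
unit*i≡0⇒i≡0 {z} u i eq with ℤP.i*j≡0⇒i≡0∨j≡0 z eq
... | inj₁ z≡0 = ⊥-elim (unit≢0 u z≡0)
... | inj₂ i≡0 = i≡0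

unit*unit : ∀ {z} → IsUnit z → z * z ≡ 1ℤ
unit*unit (inj₁ refl) = refl
unit*unit (inj₂ refl) = refl

∣unit*i∣≡∣i∣ : ∀ {z} → IsUnit z → ∀ i → ∣ z * i ∣ ≡ ∣ i ∣
∣unit*i∣≡∣i∣ (inj₁ refl) i = cong ∣_∣ (ℤP.*-identityˡ i)
∣unit*i∣≡∣i∣ (inj₂ refl) i = trans (cong ∣_∣ (ℤP.-1*i≡-i i)) (ℤP.∣-i∣≡∣i∣ i)

vec-apply : ∀ g P Q → vec (apply g P) (apply g Q) ≡ linear g (vec P Q)
vec-apply g (x₁ , y₁) (x₂ , y₂) = cong₂ _,_ (expand a b e) (expand c d f)
  where
  open IntAffine g
  expand : ∀ a b e → (a * x₂ + b * y₂ + e) - (a * x₁ + b * y₁ + e) ≡ a * (x₂ - x₁) + b * (y₂ - y₁)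
  expand a b e = solve (a ∷ b ∷ e ∷ x₁ ∷ y₁ ∷ x₂ ∷ y₂ ∷ [])

det-linear : ∀ g u w → det (linear g u) (linear g w) ≡ linearDet g * det u w
det-linear g (u₁ , u₂) (w₁ , w₂) = expand a b c d
  where
  open IntAffine g
  expand : ∀ a b c d → (a * u₁ + b * u₂) * (c * w₁ + d * w₂) - (c * u₁ + d * u₂) * (a * w₁ + b * w₂)
                     ≡ (a * d - b * c) * (u₁ * w₂ - u₂ * w₁)
  expand a b c d = solve (a ∷ b ∷ c ∷ d ∷ u₁ ∷ u₂ ∷ w₁ ∷ w₂ ∷ [])

-- Since the determinant D is ±1, the inverse matrix is D times the adjugate.
inverse : IntAffine → IntAffine
inverse g = record
  { a = a′ ; b = b′ ; c = c′ ; d = d′ ; e = - (a′ * e + b′ * f) ; f = - (c′ * e + d′ * f)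
  ; unimodular = subst IsUnit (sym det-inverse) unimodular }
  where
  open IntAffine g
  D = a * d - b * c
  a′ = D * d
  b′ = D * - b
  c′ = D * - c
  d′ = D * a
  det-inverse : a′ * d′ - b′ * c′ ≡ D
  det-inverse = begin
    a′ * d′ - b′ * c′ ≡⟨ expand a b c d ⟩
    (D * D) * D       ≡⟨ cong (_* D) (unit*unit unimodular) ⟩
    1ℤ * D            ≡⟨ ℤP.*-identityˡ D ⟩
    D                 ∎
    where
    open ≡-Reasoning
    expand : ∀ a b c d → let D = a * d - b * c in
             (D * d) * (D * a) - (D * - b) * (D * - c) ≡ (D * D) * D
    expand = solve-∀

unit²*i≡i : ∀ {z} → IsUnit z → ∀ i → (z * z) * i ≡ i
unit²*i≡i u i = trans (cong (_* i) (unit*unit u)) (ℤP.*-identityˡ i)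

apply-inverseˡ : ∀ g P → apply (inverse g) (apply g P) ≡ P
apply-inverseˡ g (x , y) =
  cong₂ _,_ (trans (expand₁ a b c d e f x y) (unit²*i≡i u x)) (trans (expand₂ a b c d e f x y) (unit²*i≡i u y))
  where
  open IntAffine g
  u = linearDet-unit g
  expand₁ : ∀ a b c d e f x y → let D = a * d - b * c in
    (D * d) * (a * x + b * y + e) + (D * - b) * (c * x + d * y + f) + - ((D * d) * e + (D * - b) * f)
    ≡ (D * D) * x
  expand₁ = solve-∀
  expand₂ : ∀ a b c d e f x y → let D = a * d - b * c in
    (D * - c) * (a * x + b * y + e) + (D * a) * (c * x + d * y + f) + - ((D * - c) * e + (D * a) * f)
    ≡ (D * D) * y
  expand₂ = solve-∀

apply-inverseʳ : ∀ g P → apply g (apply (inverse g) P) ≡ P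
apply-inverseʳ g (x , y) = cong₂ _,_ (trans (expand₁ a b c d e f x y) (fix x e)) (trans (expand₂ a b c d e f x y) (fix y f))
  where
  open IntAffine g
  fix : ∀ x e → (linearDet g * linearDet g) * x + (1ℤ - linearDet g * linearDet g) * e ≡ x
  fix x e = trans (cong (λ s → s * x + (1ℤ - s) * e) (unit*unit (linearDet-unit g))) (simplify x e)
    where
    simplify : ∀ x e → 1ℤ * x + (1ℤ - 1ℤ) * e ≡ x
    simplify = solve-∀
  expand₁ : ∀ a b c d e f x y → let D = a * d - b * c in
    a * ((D * d) * x + (D * - b) * y + - ((D * d) * e + (D * - b) * f))
      + b * ((D * - c) * x + (D * a) * y + - ((D * - c) * e + (D * a) * f)) + e
    ≡ (D * D) * x + (1ℤ - D * D) * e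
  expand₁ = solve-∀
  expand₂ : ∀ a b c d e f x y → let D = a * d - b * c in
    c * ((D * d) * x + (D * - b) * y + - ((D * d) * e + (D * - b) * f))
      + d * ((D * - c) * x + (D * a) * y + - ((D * - c) * e + (D * a) * f)) + f
    ≡ (D * D) * y + (1ℤ - D * D) * f
  expand₂ = solve-∀

apply-injective : ∀ g {P Q} → apply g P ≡ apply g Q → P ≡ Q
apply-injective g {P} {Q} eq =
  trans (sym (apply-inverseˡ g P)) (trans (cong (apply (inverse g)) eq) (apply-inverseˡ g Q))

vlength : Vector → ℕ
vlength (x , y) = gcd ∣ x ∣ ∣ y ∣

vlength∣proj₁ : ∀ v → + vlength v ℤD.∣ proj₁ v
vlength∣proj₁ (x , y) = ℤD.∣ᵤ⇒∣ (gcd[m,n]∣m ∣ x ∣ ∣ y ∣)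

vlength∣proj₂ : ∀ v → + vlength v ℤD.∣ proj₂ v
vlength∣proj₂ (x , y) = ℤD.∣ᵤ⇒∣ (gcd[m,n]∣n ∣ x ∣ ∣ y ∣)

vlength∣combination : ∀ s t v → + vlength v ℤD.∣ s * proj₁ v + t * proj₂ v
vlength∣combination s t v =
  ℤD.∣m∣n⇒∣m+n (ℤD.∣n⇒∣m*n s (vlength∣proj₁ v)) (ℤD.∣n⇒∣m*n t (vlength∣proj₂ v))

vlength∣det : ∀ v w → + vlength v ℤD.∣ det v w
vlength∣det v@(v₁ , v₂) (w₁ , w₂) = subst (+ vlength v ℤD.∣_) rearrange (vlength∣combination w₂ (- w₁) v)
  where
  rearrange : w₂ * v₁ + - w₁ * v₂ ≡ v₁ * w₂ - v₂ * w₁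
  rearrange = solve (v₁ ∷ v₂ ∷ w₁ ∷ w₂ ∷ [])

vlength∣vlength-linear : ∀ g v → vlength v ℕD.∣ vlength (linear g v)
vlength∣vlength-linear g v = gcd-greatest (ℤD.∣⇒∣ᵤ (vlength∣combination a b v)) (ℤD.∣⇒∣ᵤ (vlength∣combination c d v))
  where open IntAffine g

intLength∣intLength-apply : ∀ g A B → intLength A B ℕD.∣ intLength (apply g A) (apply g B)
intLength∣intLength-apply g A B =
  subst (intLength A B ℕD.∣_) (cong vlength (sym (vec-apply g A B))) (vlength∣vlength-linear g (vec A B))

intLength-apply : ∀ g A B → intLength (apply g A) (apply g B) ≡ intLength A B
intLength-apply g A B = ℕD.∣-antisym
  (subst₂ (λ P Q → intLength (apply g A) (apply g B) ℕD.∣ intLength P Q) (apply-inverseˡ g A) (apply-inverseˡ g B)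
     (intLength∣intLength-apply (inverse g) (apply g A) (apply g B)))
  (intLength∣intLength-apply g A B)

intLength-sym : ∀ A B → intLength A B ≡ intLength B A
intLength-sym (x₁ , y₁) (x₂ , y₂) = cong₂ gcd (∣-swap x₂ x₁) (∣-swap y₂ y₁)
  where
  ∣-swap : ∀ x y → ∣ x - y ∣ ≡ ∣ y - x ∣
  ∣-swap x y = trans (sym (ℤP.∣-i∣≡∣i∣ (x - y))) (cong ∣_∣ negate)
    where
    negate : - (x - y) ≡ y - x
    negate = solve (x ∷ y ∷ [])

vlength≡0⇒≡0 : ∀ v → vlength v ≡ 0 → v ≡ (0ℤ , 0ℤ)
vlength≡0⇒≡0 (x , y) eq = cong₂ _,_ (ℤP.∣i∣≡0⇒i≡0 (gcd[m,n]≡0⇒m≡0 eq)) (ℤP.∣i∣≡0⇒i≡0 (gcd[m,n]≡0⇒n≡0 ∣ x ∣ eq))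

vlength-scale : ∀ p v → vlength ((+ p) ·ᵥ v) ≡ p ℕ.* vlength v
vlength-scale p (x , y) =
  trans (cong₂ gcd (ℤP.abs-* (+ p) x) (ℤP.abs-* (+ p) y)) (sym (c*gcd[m,n]≡gcd[cm,cn] p ∣ x ∣ ∣ y ∣))

_div₀_ : ℕ → ℕ → ℕ
N div₀ zero = zero
N div₀ suc L = N ℕ./ suc L

div₀-injective : ∀ {N N′} L → ¬ L ≡ 0 → L ℕD.∣ N → L ℕD.∣ N′ → N div₀ L ≡ N′ div₀ L → N ≡ N′
div₀-injective zero    L≢0 _    _     _  = ⊥-elim (L≢0 refl)
div₀-injective (suc L) _   L∣N L∣N′ eq = trans (sym (ℕDM.m/n*n≡m L∣N)) (trans (cong (ℕ._* suc L) eq) (ℕDM.m/n*n≡m L∣N′))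

div₀-monoˡ-≤ : ∀ {N N′} L → N ≤ N′ → N div₀ L ≤ N′ div₀ L
div₀-monoˡ-≤ zero    _    = z≤n
div₀-monoˡ-≤ (suc L) N≤N′ = ℕDM./-monoˡ-≤ (suc L) N≤N′

intDist-unfold : ∀ X B C → intDist X B C ≡ ∣ det (vec B C) (vec B X) ∣ div₀ intLength B C
intDist-unfold X B C with intLength B C
... | zero  = refl
... | suc _ = refl

intDist-apply : ∀ g X B C → intDist (apply g X) (apply g B) (apply g C) ≡ intDist X B C
intDist-apply g X B C = begin
  intDist (apply g X) (apply g B) (apply g C)
    ≡⟨ intDist-unfold (apply g X) (apply g B) (apply g C) ⟩
  ∣ det (vec (apply g B) (apply g C)) (vec (apply g B) (apply g X)) ∣ div₀ intLength (apply g B) (apply g C)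
    ≡⟨ cong₂ (λ u w → ∣ det u w ∣ div₀ intLength (apply g B) (apply g C)) (vec-apply g B C) (vec-apply g B X) ⟩
  ∣ det (linear g (vec B C)) (linear g (vec B X)) ∣ div₀ intLength (apply g B) (apply g C)
    ≡⟨ cong₂ _div₀_ (trans (cong ∣_∣ (det-linear g (vec B C) (vec B X))) (∣unit*i∣≡∣i∣ (linearDet-unit g) _))
                    (intLength-apply g B C) ⟩
  ∣ det (vec B C) (vec B X) ∣ div₀ intLength B C
    ≡⟨ intDist-unfold X B C ⟨
  intDist X B C ∎
  where open ≡-Reasoning

intDist-swap : ∀ X B C → intDist X B C ≡ intDist X C B
intDist-swap X@(x₁ , x₂) B@(b₁ , b₂) C@(c₁ , c₂) = begin
  intDist X B C                                       ≡⟨ intDist-unfold X B C ⟩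
  ∣ det (vec B C) (vec B X) ∣ div₀ intLength B C      ≡⟨ cong₂ _div₀_ ∣det∣-swap (intLength-sym B C) ⟩
  ∣ det (vec C B) (vec C X) ∣ div₀ intLength C B      ≡⟨ intDist-unfold X C B ⟨
  intDist X C B ∎
  where
  open ≡-Reasoning
  ∣det∣-swap : ∣ det (vec B C) (vec B X) ∣ ≡ ∣ det (vec C B) (vec C X) ∣
  ∣det∣-swap = trans (cong ∣_∣ expand) (ℤP.∣-i∣≡∣i∣ (det (vec C B) (vec C X)))
    where
    expand : (c₁ - b₁) * (x₂ - b₂) - (c₂ - b₂) * (x₁ - b₁) ≡ - ((b₁ - c₁) * (x₂ - c₂) - (b₂ - c₂) * (x₁ - c₁))
    expand = solve (b₁ ∷ b₂ ∷ c₁ ∷ c₂ ∷ x₁ ∷ x₂ ∷ [])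

intDist≡1⇒nondegenerate : ∀ Y B C → intDist Y B C ≡ 1 → ¬ det (vec B C) (vec B Y) ≡ 0ℤ
intDist≡1⇒nondegenerate Y B C dist≡1 det≡0 = zero≢one (intLength B C)
  (trans (cong (λ z → ∣ z ∣ div₀ intLength B C) (sym det≡0)) (trans (sym (intDist-unfold Y B C)) dist≡1))
  where
  zero≢one : ∀ L → ¬ 0 div₀ L ≡ 1
  zero≢one zero    ()
  zero≢one (suc L) ()

linear-·ᵥ : ∀ g k u → k ·ᵥ linear g u ≡ linear g (k ·ᵥ u)
linear-·ᵥ g k (x , y) = cong₂ _,_ (expand a b) (expand c d)
  where
  open IntAffine g
  expand : ∀ a b → k * (a * x + b * y) ≡ a * (k * x) + b * (k * y)
  expand a b = solve (a ∷ b ∷ k ∷ x ∷ y ∷ [])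

linear-+ᵥ : ∀ g u w → linear g u +ᵥ linear g w ≡ linear g (u +ᵥ w)
linear-+ᵥ g (x , y) (x′ , y′) = cong₂ _,_ (expand a b) (expand c d)
  where
  open IntAffine g
  expand : ∀ a b → (a * x + b * y) + (a * x′ + b * y′) ≡ a * (x + x′) + b * (y + y′)
  expand a b = solve (a ∷ b ∷ x ∷ y ∷ x′ ∷ y′ ∷ [])

linear-combination : ∀ g s t u w → linear g ((s ·ᵥ u) +ᵥ (t ·ᵥ w)) ≡ (s ·ᵥ linear g u) +ᵥ (t ·ᵥ linear g w)
linear-combination g s t u w = trans (sym (linear-+ᵥ g (s ·ᵥ u) (t ·ᵥ w)))
  (cong₂ _+ᵥ_ (sym (linear-·ᵥ g s u)) (sym (linear-·ᵥ g t w)))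

InAngle-apply : ∀ g A B C X → InAngle A B C X → InAngle (apply g A) (apply g B) (apply g C) (apply g X)
InAngle-apply g A B C X (p , q , r , r>0 , eq) = p , q , r , r>0 , (begin
  (+ r) ·ᵥ vec (apply g B) (apply g X)               ≡⟨ cong ((+ r) ·ᵥ_) (vec-apply g B X) ⟩
  (+ r) ·ᵥ linear g (vec B X)                        ≡⟨ linear-·ᵥ g (+ r) (vec B X) ⟩
  linear g ((+ r) ·ᵥ vec B X)                        ≡⟨ cong (linear g) eq ⟩
  linear g (((+ p) ·ᵥ vec B A) +ᵥ ((+ q) ·ᵥ vec B C)) ≡⟨ linear-combination g (+ p) (+ q) (vec B A) (vec B C) ⟩
  ((+ p) ·ᵥ linear g (vec B A)) +ᵥ ((+ q) ·ᵥ linear g (vec B C))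
    ≡⟨ cong₂ (λ u w → ((+ p) ·ᵥ u) +ᵥ ((+ q) ·ᵥ w)) (vec-apply g B A) (vec-apply g B C) ⟨
  ((+ p) ·ᵥ vec (apply g B) (apply g A)) +ᵥ ((+ q) ·ᵥ vec (apply g B) (apply g C)) ∎)
  where open ≡-Reasoning

InAngle-swap : ∀ A B C X → InAngle A B C X → InAngle C B A X
InAngle-swap A B C X (p , q , r , r>0 , eq) = q , p , r , r>0 , trans eq (+ᵥ-comm ((+ p) ·ᵥ vec B A) ((+ q) ·ᵥ vec B C))
  where
  +ᵥ-comm : ∀ u w → u +ᵥ w ≡ w +ᵥ u
  +ᵥ-comm (u₁ , u₂) (w₁ , w₂) = cong₂ _,_ (ℤP.+-comm u₁ w₁) (ℤP.+-comm u₂ w₂)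

IsBPrime-apply : ∀ g A B C X → IsBPrime A B C X → IsBPrime (apply g A) (apply g B) (apply g C) (apply g X)
IsBPrime-apply g A B C X (∠X , distX , closest) =
  InAngle-apply g A B C X ∠X , trans (intDist-apply g X B C) distX , closest′
  where
  g⁻¹ = inverse g
  pull : ∀ Y P Q → intDist Y (apply g P) (apply g Q) ≡ intDist (apply g⁻¹ Y) P Q
  pull Y P Q = trans (cong (λ Z → intDist Z (apply g P) (apply g Q)) (sym (apply-inverseʳ g Y)))
                     (intDist-apply g (apply g⁻¹ Y) P Q)
  pull∠ : ∀ Y → InAngle (apply g A) (apply g B) (apply g C) Y → InAngle A B C (apply g⁻¹ Y)
  pull∠ Y ∠Y = subst₃ (λ A′ B′ C′ → InAngle A′ B′ C′ (apply g⁻¹ Y))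
    (apply-inverseˡ g A) (apply-inverseˡ g B) (apply-inverseˡ g C) (InAngle-apply g⁻¹ _ _ _ Y ∠Y)
  closest′ : ∀ Y → InAngle (apply g A) (apply g B) (apply g C) Y → intDist Y (apply g B) (apply g C) ≡ 1 →
             intDist (apply g X) (apply g B) (apply g A) ≤ intDist Y (apply g B) (apply g A)
  closest′ Y ∠Y distY = subst₂ _≤_ (sym (intDist-apply g X B A)) (sym (pull Y B A))
    (closest (apply g⁻¹ Y) (pull∠ Y ∠Y) (trans (sym (pull Y B C)) distY))

IsCPrime⇒IsBPrime : ∀ B C D X → IsCPrime B C D X → IsBPrime D C B X
IsCPrime⇒IsBPrime B C D X (∠X , distX , closest) =
  InAngle-swap B C D X ∠X , trans (sym (intDist-swap X B C)) distX ,
  λ Y ∠Y distY → closest Y (InAngle-swap D C B Y ∠Y) (trans (intDist-swap Y B C) distY)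

IsBPrime⇒IsCPrime : ∀ B C D X → IsBPrime D C B X → IsCPrime B C D X
IsBPrime⇒IsCPrime B C D X (∠X , distX , closest) =
  InAngle-swap D C B X ∠X , trans (intDist-swap X B C) distX ,
  λ Y ∠Y distY → closest Y (InAngle-swap B C D Y ∠Y) (trans (sym (intDist-swap Y B C)) distY)

IsCPrime-apply : ∀ g B C D X → IsCPrime B C D X → IsCPrime (apply g B) (apply g C) (apply g D) (apply g X)
IsCPrime-apply g B C D X =
  IsBPrime⇒IsCPrime (apply g B) (apply g C) (apply g D) (apply g X) ∘ IsBPrime-apply g D C B X ∘ IsCPrime⇒IsBPrime B C D X

·ᵥ-cancelˡ : ∀ k {u w} → ¬ k ≡ 0ℤ → k ·ᵥ u ≡ k ·ᵥ w → u ≡ w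
·ᵥ-cancelˡ k {u₁ , u₂} {w₁ , w₂} k≢0 eq = cong₂ _,_ (ℤP.*-cancelˡ-≡ k u₁ w₁ (cong proj₁ eq)) (ℤP.*-cancelˡ-≡ k u₂ w₂ (cong proj₂ eq))
  where instance _ = ≢-nonZero k≢0

SameDir-refl : ∀ u → SameDir u u
SameDir-refl u = 1 , 1 , s≤s z≤n , s≤s z≤n , refl

SameDir⇒≡ : ∀ u w → SameDir u w → vlength u ≡ vlength w → u ≡ w
SameDir⇒≡ u w (suc p , suc q , _ , _ , pu≡qw) eqL with vlength u ℕ.≟ 0
... | yes u≡0 = trans (vlength≡0⇒≡0 u u≡0) (sym (vlength≡0⇒≡0 w (trans (sym eqL) u≡0)))
... | no u≢0  = ·ᵥ-cancelˡ (+[1+ p ]) (λ ()) (trans pu≡qw (cong (λ k → (+ k) ·ᵥ w) (sym p≡q)))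
  where
  p≡q : suc p ≡ suc q
  p≡q = ℕP.*-cancelʳ-≡ (suc p) (suc q) (vlength u) {{ℕ.≢-nonZero u≢0}} (begin
    suc p ℕ.* vlength u     ≡⟨ vlength-scale (suc p) u ⟨
    vlength (+[1+ p ] ·ᵥ u) ≡⟨ cong vlength pu≡qw ⟩
    vlength (+[1+ q ] ·ᵥ w) ≡⟨ vlength-scale (suc q) w ⟩
    suc q ℕ.* vlength w     ≡⟨ cong (suc q ℕ.*_) eqL ⟨
    suc q ℕ.* vlength u     ∎)
    where open ≡-Reasoning

vec-injective : ∀ P {X Y} → vec P X ≡ vec P Y → X ≡ Y
vec-injective (p₁ , p₂) {x₁ , x₂} {y₁ , y₂} eq = cong₂ _,_ (unshift (cong proj₁ eq)) (unshift (cong proj₂ eq))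
  where
  unshift : ∀ {x y p} → x - p ≡ y - p → x ≡ y
  unshift {x} {y} {p} eq = trans (sym (shift x p)) (trans (cong (_+ p) eq) (shift y p))
    where
    shift : ∀ x p → (x - p) + p ≡ x
    shift = solve-∀

-- An integer point on a given ray is determined by its integer distance from the vertex.
ray-point : ∀ g A B A′ B′ → apply g B ≡ B′ → SameDir (vec (apply g B) (apply g A)) (vec B′ A′) →
            intLength B A ≡ intLength B′ A′ → apply g A ≡ A′
ray-point g A B A′ B′ refl sameDir eqL =
  vec-injective B′ (SameDir⇒≡ _ _ sameDir (trans (intLength-apply g B A) eqL))

apply-split : ∀ g P Z → apply g Z ≡ apply g P +ᵥ linear g (vec P Z)
apply-split g (p₁ , p₂) (z₁ , z₂) = cong₂ _,_ (expand a b e) (expand c d f)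
  where
  open IntAffine g
  expand : ∀ a b e → a * z₁ + b * z₂ + e ≡ (a * p₁ + b * p₂ + e) + (a * (z₁ - p₁) + b * (z₂ - p₂))
  expand a b e = solve (a ∷ b ∷ e ∷ z₁ ∷ z₂ ∷ p₁ ∷ p₂ ∷ [])

cramer : ∀ u w t → det u w ·ᵥ t ≡ (det t w ·ᵥ u) +ᵥ (det u t ·ᵥ w)
cramer (u₁ , u₂) (w₁ , w₂) (t₁ , t₂) = cong₂ _,_ expand₁ expand₂
  where
  expand₁ : (u₁ * w₂ - u₂ * w₁) * t₁ ≡ (t₁ * w₂ - t₂ * w₁) * u₁ + (u₁ * t₂ - u₂ * t₁) * w₁
  expand₁ = solve (u₁ ∷ u₂ ∷ w₁ ∷ w₂ ∷ t₁ ∷ t₂ ∷ [])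
  expand₂ : (u₁ * w₂ - u₂ * w₁) * t₂ ≡ (t₁ * w₂ - t₂ * w₁) * u₂ + (u₁ * t₂ - u₂ * t₁) * w₂
  expand₂ = solve (u₁ ∷ u₂ ∷ w₁ ∷ w₂ ∷ t₁ ∷ t₂ ∷ [])

-- Cramer's rule expresses every vector through two independent ones, on which g and h agree.
agree-on-triangle : ∀ g h P Q R → apply g P ≡ apply h P → apply g Q ≡ apply h Q → apply g R ≡ apply h R →
                    ¬ det (vec P Q) (vec P R) ≡ 0ℤ → ∀ Z → apply g Z ≡ apply h Z
agree-on-triangle g h P Q R gP gQ gR independent Z = begin
  apply g Z                      ≡⟨ apply-split g P Z ⟩
  apply g P +ᵥ linear g (vec P Z) ≡⟨ cong₂ _+ᵥ_ gP (·ᵥ-cancelˡ (det u w) independent (trans (expand g) (trans agree (sym (expand h))))) ⟩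
  apply h P +ᵥ linear h (vec P Z) ≡⟨ apply-split h P Z ⟨
  apply h Z                      ∎
  where
  open ≡-Reasoning
  u = vec P Q
  w = vec P R
  t = vec P Z
  linear-agrees : ∀ X → apply g X ≡ apply h X → linear g (vec P X) ≡ linear h (vec P X)
  linear-agrees X gX = trans (sym (vec-apply g P X)) (trans (cong₂ vec gP gX) (vec-apply h P X))
  expand : ∀ k → det u w ·ᵥ linear k t ≡ (det t w ·ᵥ linear k u) +ᵥ (det u t ·ᵥ linear k w)
  expand k = trans (linear-·ᵥ k (det u w) t) (trans (cong (linear k) (cramer u w t)) (linear-combination k (det t w) (det u t) u w))
  agree : (det t w ·ᵥ linear g u) +ᵥ (det u t ·ᵥ linear g w) ≡ (det t w ·ᵥ linear h u) +ᵥ (det u t ·ᵥ linear h w)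
  agree = cong₂ (λ x y → (det t w ·ᵥ x) +ᵥ (det u t ·ᵥ y)) (linear-agrees Q gQ) (linear-agrees R gR)

orient-apply : ∀ g P Q R → orient (apply g P) (apply g Q) (apply g R) ≡ linearDet g * orient P Q R
orient-apply g P Q R = trans (cong₂ det (vec-apply g Q P) (vec-apply g Q R)) (det-linear g (vec Q P) (vec Q R))

SameSign : ℤ → ℤ → Set
SameSign x y = (x >ℤ 0ℤ × y >ℤ 0ℤ) ⊎ (x <ℤ 0ℤ × y <ℤ 0ℤ)

SameSign⇒≢0ˡ : ∀ {x y} → SameSign x y → ¬ x ≡ 0ℤ
SameSign⇒≢0ˡ (inj₁ (x>0 , _)) refl = ℤP.<-irrefl refl x>0
SameSign⇒≢0ˡ (inj₂ (x<0 , _)) refl = ℤP.<-irrefl refl x<0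

SameSign⇒≢0ʳ : ∀ {x y} → SameSign x y → ¬ y ≡ 0ℤ
SameSign⇒≢0ʳ (inj₁ (_ , y>0)) refl = ℤP.<-irrefl refl y>0
SameSign⇒≢0ʳ (inj₂ (_ , y<0)) refl = ℤP.<-irrefl refl y<0

SameSign-unit* : ∀ {z x y} → IsUnit z → SameSign x y → SameSign (z * x) (z * y)
SameSign-unit* {x = x} {y} (inj₁ refl) s rewrite ℤP.*-identityˡ x | ℤP.*-identityˡ y = s
SameSign-unit* {x = x} {y} (inj₂ refl) s rewrite ℤP.-1*i≡-i x | ℤP.-1*i≡-i y with s
... | inj₁ (x>0 , y>0) = inj₂ (ℤP.neg-mono-< x>0 , ℤP.neg-mono-< y>0)
... | inj₂ (x<0 , y<0) = inj₁ (ℤP.neg-mono-< x<0 , ℤP.neg-mono-< y<0)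

-- Local convexity at the two middle vertices of A B C D.
Convex₂ : Point → Point → Point → Point → Set
Convex₂ A B C D = SameSign (orient A B C) (orient B C D)

Convex₂-apply : ∀ g A B C D → Convex₂ A B C D → Convex₂ (apply g A) (apply g B) (apply g C) (apply g D)
Convex₂-apply g A B C D s = subst₂ SameSign (sym (orient-apply g A B C)) (sym (orient-apply g B C D))
  (SameSign-unit* (linearDet-unit g) s)

det-antisym : ∀ u w → det u w ≡ - det w u
det-antisym (u₁ , u₂) (w₁ , w₂) = expand
  where
  expand : u₁ * w₂ - u₂ * w₁ ≡ - (w₁ * u₂ - w₂ * u₁)
  expand = solve (u₁ ∷ u₂ ∷ w₁ ∷ w₂ ∷ [])

det≢0-negate : ∀ u w → ¬ det u w ≡ 0ℤ → ¬ det w u ≡ 0ℤ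
det≢0-negate u w d≢0 d≡0 = d≢0 (trans (det-antisym u w) (cong -_ d≡0))

origin : Point
origin = (0ℤ , 0ℤ)

vec-origin : ∀ P → vec origin P ≡ P
vec-origin (x , y) = cong₂ _,_ (ℤP.+-identityʳ x) (ℤP.+-identityʳ y)

unit-normalise : ∀ z → ¬ z ≡ 0ℤ → Σ ℤ λ s → Σ ℕ λ m → IsUnit s × s * z ≡ +[1+ m ]
unit-normalise +0       z≢0 = ⊥-elim (z≢0 refl)
unit-normalise +[1+ m ] _   = 1ℤ , m , inj₁ refl , ℤP.*-identityˡ +[1+ m ]
unit-normalise -[1+ m ] _   = -1ℤ , m , inj₂ refl , ℤP.-1*i≡-i -[1+ m ]

+∣i∣≡s*i : ∀ i → Σ ℤ λ s → + ∣ i ∣ ≡ s * i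
+∣i∣≡s*i i with ℤP.+∣i∣≡i⊎+∣i∣≡-i i
... | inj₁ eq = 1ℤ , trans eq (sym (ℤP.*-identityˡ i))
... | inj₂ eq = -1ℤ , trans eq (sym (ℤP.-1*i≡-i i))

pos-difference : ∀ {d m n} → d ℕ.+ n ≡ m → + d ≡ + m - + n
pos-difference {d} {m} {n} eq = begin
  + d                 ≡⟨ cancel (+ d) (+ n) ⟩
  (+ d + + n) - + n   ≡⟨ cong (_- + n) (trans (sym (ℤP.pos-+ d n)) (cong +_ eq)) ⟩
  + m - + n           ∎
  where
  open ≡-Reasoning
  cancel : ∀ a b → a ≡ (a + b) - b
  cancel = solve-∀

bezout : ∀ i j → Σ ℤ λ α → Σ ℤ λ β → + gcd ∣ i ∣ ∣ j ∣ ≡ α * i + β * j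
bezout i j with +∣i∣≡s*i i | +∣i∣≡s*i j | Bézout.identity (gcd-GCD ∣ i ∣ ∣ j ∣)
... | s , eqi | t , eqj | Bézout.+- x y eq = + x * s , - (+ y) * t , (begin
  + gcd ∣ i ∣ ∣ j ∣                 ≡⟨ pos-difference eq ⟩
  + (x ℕ.* ∣ i ∣) - + (y ℕ.* ∣ j ∣) ≡⟨ cong₂ _-_ (ℤP.pos-* x ∣ i ∣) (ℤP.pos-* y ∣ j ∣) ⟩
  + x * + ∣ i ∣ - + y * + ∣ j ∣     ≡⟨ cong₂ (λ p q → + x * p - + y * q) eqi eqj ⟩
  + x * (s * i) - + y * (t * j)     ≡⟨ regroup (+ x) (+ y) s t i j ⟩
  + x * s * i + - (+ y) * t * j     ∎)
  where
  open ≡-Reasoning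
  regroup : ∀ x y s t i j → x * (s * i) - y * (t * j) ≡ x * s * i + - y * t * j
  regroup = solve-∀
... | s , eqi | t , eqj | Bézout.-+ x y eq = - (+ x) * s , + y * t , (begin
  + gcd ∣ i ∣ ∣ j ∣                 ≡⟨ pos-difference eq ⟩
  + (y ℕ.* ∣ j ∣) - + (x ℕ.* ∣ i ∣) ≡⟨ cong₂ _-_ (ℤP.pos-* y ∣ j ∣) (ℤP.pos-* x ∣ i ∣) ⟩
  + y * + ∣ j ∣ - + x * + ∣ i ∣     ≡⟨ cong₂ (λ q p → + y * q - + x * p) eqj eqi ⟩
  + y * (t * j) - + x * (s * i)     ≡⟨ regroup (+ x) (+ y) s t i j ⟩
  - (+ x) * s * i + + y * t * j     ∎)
  where
  open ≡-Reasoning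
  regroup : ∀ x y s t i j → y * (t * j) - x * (s * i) ≡ - x * s * i + y * t * j
  regroup = solve-∀

-- The map u ↦ (α u₁ + β u₂ , s det(e, u)) with e = (e₁ , e₂) primitive and α e₁ + β e₂ = 1
-- sends e to (1 , 0); it is composed with the translation taking B to the origin.
module StandardMap (s α β e₁ e₂ : ℤ) (B : Point) (s-unit : IsUnit s) (bez : α * e₁ + β * e₂ ≡ 1ℤ) where

  map : IntAffine
  map = record
    { a = α ; b = β ; c = s * - e₂ ; d = s * e₁
    ; e = - (α * proj₁ B + β * proj₂ B) ; f = - ((s * - e₂) * proj₁ B + (s * e₁) * proj₂ B)
    ; unimodular = subst IsUnit (sym det≡s) s-unit }
    where
    det≡s : α * (s * e₁) - β * (s * - e₂) ≡ s
    det≡s = trans (expand α β s e₁ e₂) (trans (cong (s *_) bez) (ℤP.*-identityʳ s))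
      where
      expand : ∀ α β s e₁ e₂ → α * (s * e₁) - β * (s * - e₂) ≡ s * (α * e₁ + β * e₂)
      expand = solve-∀

  apply-B : apply map B ≡ origin
  apply-B = cong₂ _,_ (cancel α β) (cancel (s * - e₂) (s * e₁))
    where
    cancel : ∀ a b → a * proj₁ B + b * proj₂ B + - (a * proj₁ B + b * proj₂ B) ≡ 0ℤ
    cancel a b = ℤP.+-inverseʳ (a * proj₁ B + b * proj₂ B)

  apply≡linear-vec : ∀ P → apply map P ≡ linear map (vec B P)
  apply≡linear-vec P = trans (apply-split map B P)
    (trans (cong (_+ᵥ linear map (vec B P)) apply-B) (cong₂ _,_ (ℤP.+-identityˡ _) (ℤP.+-identityˡ _)))

  linear-multiple : ∀ L → linear map (e₁ * L , e₂ * L) ≡ (L , 0ℤ)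
  linear-multiple L = cong₂ _,_ (trans (expand₁ α β e₁ e₂ L) (trans (cong (_* L) bez) (ℤP.*-identityˡ L)))
                          (expand₂ s e₁ e₂ L)
    where
    expand₁ : ∀ α β e₁ e₂ L → α * (e₁ * L) + β * (e₂ * L) ≡ (α * e₁ + β * e₂) * L
    expand₁ = solve-∀
    expand₂ : ∀ s e₁ e₂ L → (s * - e₂) * (e₁ * L) + (s * e₁) * (e₂ * L) ≡ 0ℤ
    expand₂ = solve-∀

  proj₂-linear : ∀ u → proj₂ (linear map u) ≡ s * det (e₁ , e₂) u
  proj₂-linear (u₁ , u₂) = expand s e₁ e₂ u₁ u₂
    where
    expand : ∀ s e₁ e₂ u₁ u₂ → (s * - e₂) * u₁ + (s * e₁) * u₂ ≡ s * (e₁ * u₂ - e₂ * u₁)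
    expand = solve-∀

onAxis : ℕ → Point
onAxis l = (+[1+ l ] , 0ℤ)

upper : ℤ → ℕ → Point
upper a m = (a , +[1+ m ])

record StandardPosition (A B C : Point) : Set where
  field
    map : IntAffine
    l : ℕ
    a : ℤ
    m : ℕ
    map-B : apply map B ≡ origin
    map-C : apply map C ≡ onAxis l
    map-A : apply map A ≡ upper a m

-- A nonzero vector is L e with L its integer length and e primitive, as witnessed by a Bézout relation.
record PrimitiveFactorisation (v : Vector) (L : ℤ) : Set where
  field
    e₁ e₂ α β : ℤ
    factorisation : v ≡ (e₁ * L , e₂ * L)
    bézout : α * e₁ + β * e₂ ≡ 1ℤ

primitiveFactorisation : ∀ v {l} → vlength v ≡ suc l → PrimitiveFactorisation v +[1+ l ]
primitiveFactorisation v {l} length≡ = record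
  { e₁ = e₁ ; e₂ = e₂ ; α = α ; β = β ; factorisation = factorisation ; bézout = ℤP.*-cancelʳ-≡ _ _ L (begin
    (α * e₁ + β * e₂) * L       ≡⟨ expand α β e₁ e₂ L ⟩
    α * (e₁ * L) + β * (e₂ * L) ≡⟨ cong₂ (λ x y → α * x + β * y) (cong proj₁ factorisation) (cong proj₂ factorisation) ⟨
    α * proj₁ v + β * proj₂ v   ≡⟨ proj₂ (proj₂ (bezout (proj₁ v) (proj₂ v))) ⟨
    + vlength v                 ≡⟨ cong +_ length≡ ⟩
    L                           ≡⟨ ℤP.*-identityˡ L ⟨
    1ℤ * L                      ∎) }
  where
  open ≡-Reasoning
  L = +[1+ l ]
  e₁ = ℤD.quotient (vlength∣proj₁ v)
  e₂ = ℤD.quotient (vlength∣proj₂ v)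
  α = proj₁ (bezout (proj₁ v) (proj₂ v))
  β = proj₁ (proj₂ (bezout (proj₁ v) (proj₂ v)))
  factorisation : v ≡ (e₁ * L , e₂ * L)
  factorisation = cong₂ _,_ (trans (ℤD._∣_.equality (vlength∣proj₁ v)) (cong (λ k → e₁ * + k) length≡))
                            (trans (ℤD._∣_.equality (vlength∣proj₂ v)) (cong (λ k → e₂ * + k) length≡))
  expand : ∀ α β e₁ e₂ L → (α * e₁ + β * e₂) * L ≡ α * (e₁ * L) + β * (e₂ * L)
  expand = solve-∀

standardPosition : ∀ A B C → ¬ det (vec B C) (vec B A) ≡ 0ℤ → StandardPosition A B C
standardPosition A B C nondegenerate with vlength (vec B C) in lengthBC
... | zero  = ⊥-elim (nondegenerate (cong (λ v → det v (vec B A)) (vlength≡0⇒≡0 (vec B C) lengthBC)))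
... | suc l = record
  { map = map ; l = l ; a = proj₁ (apply map A) ; m = m
  ; map-B = apply-B
  ; map-C = trans (apply≡linear-vec C) (trans (cong (linear map) factorisation) (linear-multiple L))
  ; map-A = cong₂ _,_ refl (trans (cong proj₂ (apply≡linear-vec A)) (trans (proj₂-linear (vec B A)) sδ≡1+m)) }
  where
  L = +[1+ l ]
  open PrimitiveFactorisation (primitiveFactorisation (vec B C) lengthBC)
  δ = det (e₁ , e₂) (vec B A)
  δ≢0 : ¬ δ ≡ 0ℤ
  δ≢0 δ≡0 = nondegenerate (begin
    det (vec B C) (vec B A)         ≡⟨ cong (λ w → det w (vec B A)) factorisation ⟩
    det (e₁ * L , e₂ * L) (vec B A) ≡⟨ expand e₁ e₂ L (proj₁ (vec B A)) (proj₂ (vec B A)) ⟩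
    L * δ                           ≡⟨ cong (L *_) δ≡0 ⟩
    L * 0ℤ                          ≡⟨ ℤP.*-zeroʳ L ⟩
    0ℤ                              ∎)
    where
    open ≡-Reasoning
    expand : ∀ e₁ e₂ L u₁ u₂ → (e₁ * L) * u₂ - (e₂ * L) * u₁ ≡ L * (e₁ * u₂ - e₂ * u₁)
    expand = solve-∀
  s = proj₁ (unit-normalise δ δ≢0)
  m = proj₁ (proj₂ (unit-normalise δ δ≢0))
  sδ≡1+m : s * δ ≡ +[1+ m ]
  sδ≡1+m = proj₂ (proj₂ (proj₂ (unit-normalise δ δ≢0)))
  open StandardMap s α β e₁ e₂ B (proj₁ (proj₂ (proj₂ (unit-normalise δ δ≢0)))) bézout

intDist-axis : ∀ l X → intDist X origin (onAxis l) ≡ ∣ proj₂ X ∣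
intDist-axis l X@(x , y) = begin
  intDist X origin (onAxis l)                      ≡⟨ intDist-unfold X origin (onAxis l) ⟩
  ∣ det (vec origin (onAxis l)) (vec origin X) ∣ div₀ intLength origin (onAxis l)
    ≡⟨ cong₂ (λ u w → ∣ det u w ∣ div₀ vlength u) (vec-origin (onAxis l)) (vec-origin X) ⟩
  ∣ +[1+ l ] * y - 0ℤ * x ∣ div₀ suc l              ≡⟨ cong (λ z → ∣ z ∣ div₀ suc l) (ℤP.+-identityʳ (+[1+ l ] * y)) ⟩
  ∣ +[1+ l ] * y ∣ div₀ suc l                       ≡⟨ cong (ℕ._/ suc l) (trans (ℤP.abs-* +[1+ l ] y) (ℕP.*-comm (suc l) ∣ y ∣)) ⟩
  ∣ y ∣ ℕ.* suc l ℕ./ suc l                         ≡⟨ ℕDM.m*n/n≡m ∣ y ∣ (suc l) ⟩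
  ∣ y ∣                                            ∎
  where open ≡-Reasoning

-- Such an angle lies in the closed upper half-plane, so it misses the line y = -1.
InAngle-height : ∀ a₁ a₂ b₁ c₁ c₂ X → InAngle (a₁ , + a₂) (b₁ , 0ℤ) (c₁ , + c₂) X → ∣ proj₂ X ∣ ≡ 1 → proj₂ X ≡ 1ℤ
InAngle-height a₁ a₂ b₁ c₁ c₂ (x , +[1+ zero ]) _ _ = refl
InAngle-height a₁ a₂ b₁ c₁ c₂ (x , -[1+ zero ]) (p , q , suc r , _ , eq) _ with begin
  +[1+ r ] * -1ℤ                                ≡⟨ cong proj₂ eq ⟩
  + p * (+ a₂ - 0ℤ) + + q * (+ c₂ - 0ℤ)        ≡⟨ cong₂ (λ x y → + p * x + + q * y) (ℤP.+-identityʳ (+ a₂)) (ℤP.+-identityʳ (+ c₂)) ⟩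
  + p * + a₂ + + q * + c₂                      ≡⟨ cong₂ _+_ (ℤP.pos-* p a₂) (ℤP.pos-* q c₂) ⟨
  + (p ℕ.* a₂) + + (q ℕ.* c₂)                  ≡⟨ ℤP.pos-+ (p ℕ.* a₂) (q ℕ.* c₂) ⟨
  + (p ℕ.* a₂ ℕ.+ q ℕ.* c₂)                    ∎
  where open ≡-Reasoning
... | ()

InAngle-at-origin : ∀ A C X → InAngle A origin C X →
  Σ ℕ λ p → Σ ℕ λ q → Σ ℕ λ r → 0 < r × (+ r) ·ᵥ X ≡ ((+ p) ·ᵥ A) +ᵥ ((+ q) ·ᵥ C)
InAngle-at-origin A C X (p , q , r , r>0 , eq) = p , q , r , r>0 ,
  subst₃ (λ A′ C′ X′ → (+ r) ·ᵥ X′ ≡ ((+ p) ·ᵥ A′) +ᵥ ((+ q) ·ᵥ C′)) (vec-origin A) (vec-origin C) (vec-origin X) eq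

InAngle-at-origin⁻¹ : ∀ A C X p q r → 0 < r → (+ r) ·ᵥ X ≡ ((+ p) ·ᵥ A) +ᵥ ((+ q) ·ᵥ C) → InAngle A origin C X
InAngle-at-origin⁻¹ A C X p q r r>0 eq = p , q , r , r>0 ,
  subst₃ (λ A′ C′ X′ → (+ r) ·ᵥ X′ ≡ ((+ p) ·ᵥ A′) +ᵥ ((+ q) ·ᵥ C′))
    (sym (vec-origin A)) (sym (vec-origin C)) (sym (vec-origin X)) eq

nonNeg-quotient : ∀ m r z → r < suc m → 0ℤ ≤ℤ +[1+ m ] * z + + r → 0ℤ ≤ℤ z
nonNeg-quotient m r (+ n)    _   _ = +≤+ z≤n
nonNeg-quotient m r -[1+ n ] r<M 0≤ = ⊥-elim (negative (ℕP.m<n⇒0<n∸m r<M′) (subst (0ℤ ≤ℤ_) (ℤP.⊖-< r<M′) 0≤))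
  where
  r<M′ : r < suc (n ℕ.+ m ℕ.* suc n)
  r<M′ = ℕP.<-≤-trans r<M (s≤s (ℕP.m≤n⇒m≤o+n n (ℕP.m≤m*n m (suc n))))
  negative : ∀ {j} → 0 < j → ¬ (0ℤ ≤ℤ - (+ j))
  negative {suc j} _ ()

module _ (a : ℤ) (m l : ℕ) where

  private
    A = upper a m
    C = onAxis l
    M = +[1+ m ]
    L = +[1+ l ]

  InAngle⇒above : ∀ x → InAngle A origin C (x , 1ℤ) → a ≤ℤ M * x
  InAngle⇒above x ∠x with InAngle-at-origin A C (x , 1ℤ) ∠x
  ... | p , q , r , r>0 , eq = above p r>0 eq₁ eq₂
    where
    eq₁ : + r * x ≡ + p * a + + q * L
    eq₁ = cong proj₁ eq
    eq₂ : + r ≡ + p * M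
    eq₂ = trans (sym (ℤP.*-identityʳ (+ r))) (trans (cong proj₂ eq) (trans (cong (λ z → + p * M + z) (ℤP.*-zeroʳ (+ q))) (ℤP.+-identityʳ (+ p * M))))
    above : ∀ p → 0 < r → + r * x ≡ + p * a + + q * L → + r ≡ + p * M → a ≤ℤ M * x
    above zero r>0 _ r≡0 = ⊥-elim (ℕP.<-irrefl (sym (ℤP.+-injective r≡0)) r>0)
    above (suc p) _ first second = ℤP.*-cancelˡ-≤-pos a (M * x) +[1+ p ] (begin
      +[1+ p ] * a                ≤⟨ ℤP.i≤i+j (+[1+ p ] * a) (+ q * L) {{nonNeg}} ⟩
      +[1+ p ] * a + + q * L      ≡⟨ first ⟨
      + r * x                     ≡⟨ cong (_* x) second ⟩
      +[1+ p ] * M * x            ≡⟨ ℤP.*-assoc +[1+ p ] M x ⟩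
      +[1+ p ] * (M * x)          ∎)
      where
      open ℤP.≤-Reasoning
      nonNeg : NonNegative (+ q * L)
      nonNeg = subst NonNegative (ℤP.pos-* q (suc l)) _

  excess≡ : ∀ x → a ≤ℤ M * x → + ∣ M * x - a ∣ ≡ M * x - a
  excess≡ x a≤Mx = ℤP.0≤i⇒+∣i∣≡i (ℤP.i≤j⇒0≤j-i a≤Mx)

  above⇒InAngle : ∀ x → a ≤ℤ M * x → InAngle A origin C (x , 1ℤ)
  above⇒InAngle x a≤Mx = InAngle-at-origin⁻¹ A C (x , 1ℤ) (suc l) ∣ M * x - a ∣ (suc m ℕ.* suc l) (s≤s z≤n)
    (cong₂ _,_ (trans (cong (_* x) r≡ML) (trans (expand₁ M L x a) (cong (λ z → L * a + z * L) (sym (excess≡ x a≤Mx)))))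
         (trans (cong (_* 1ℤ) r≡ML) (expand₂ M L (+ ∣ M * x - a ∣))))
    where
    r≡ML : + (suc m ℕ.* suc l) ≡ M * L
    r≡ML = ℤP.pos-* (suc m) (suc l)
    expand₁ : ∀ M L x a → (M * L) * x ≡ L * a + (M * x - a) * L
    expand₁ = solve-∀
    expand₂ : ∀ M L Q → (M * L) * 1ℤ ≡ L * M + Q * 0ℤ
    expand₂ = solve-∀

  ∣det-A∣ : ∀ x → ∣ det A (x , 1ℤ) ∣ ≡ ∣ M * x - a ∣
  ∣det-A∣ x = trans (sym (ℤP.∣-i∣≡∣i∣ (a * 1ℤ - M * x))) (cong ∣_∣ (negate a M x))
    where
    negate : ∀ a M x → - (a * 1ℤ - M * x) ≡ M * x - a
    negate = solve-∀

  distA : ℤ → ℕ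
  distA x = intDist (x , 1ℤ) origin A

  distA-unfold : ∀ x → distA x ≡ ∣ M * x - a ∣ div₀ vlength A
  distA-unfold x = trans (intDist-unfold (x , 1ℤ) origin A)
    (trans (cong₂ (λ u w → ∣ det u w ∣ div₀ vlength u) (vec-origin A) (vec-origin (x , 1ℤ)))
           (cong (_div₀ vlength A) (∣det-A∣ x)))

  vlengthA∣excess : ∀ x → vlength A ℕD.∣ ∣ M * x - a ∣
  vlengthA∣excess x = subst (vlength A ℕD.∣_) (∣det-A∣ x) (ℤD.∣⇒∣ᵤ (vlength∣det A (x , 1ℤ)))

  vlengthA≢0 : ¬ vlength A ≡ 0
  vlengthA≢0 eq with cong proj₂ (vlength≡0⇒≡0 A eq)
  ... | ()

  distA-injective : ∀ x x′ → a ≤ℤ M * x → a ≤ℤ M * x′ → distA x ≡ distA x′ → x ≡ x′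
  distA-injective x x′ a≤Mx a≤Mx′ eq = ℤP.*-cancelˡ-≡ M x x′ (begin
    M * x                   ≡⟨ shift (M * x) a ⟨
    (M * x - a) + a         ≡⟨ cong (_+ a) (excess≡ x a≤Mx) ⟨
    + ∣ M * x - a ∣ + a     ≡⟨ cong (λ n → + n + a) same-excess ⟩
    + ∣ M * x′ - a ∣ + a    ≡⟨ cong (_+ a) (excess≡ x′ a≤Mx′) ⟩
    (M * x′ - a) + a        ≡⟨ shift (M * x′) a ⟩
    M * x′                  ∎)
    where
    open ≡-Reasoning
    shift : ∀ y a → (y - a) + a ≡ y
    shift = solve-∀
    same-excess : ∣ M * x - a ∣ ≡ ∣ M * x′ - a ∣
    same-excess = div₀-injective (vlength A) vlengthA≢0 (vlengthA∣excess x) (vlengthA∣excess x′)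
      (trans (sym (distA-unfold x)) (trans eq (distA-unfold x′)))

  height-one : ∀ X → InAngle A origin C X → intDist X origin C ≡ 1 → proj₂ X ≡ 1ℤ
  height-one X ∠X distX = InAngle-height a (suc m) 0ℤ +[1+ l ] 0 X ∠X (trans (sym (intDist-axis l X)) distX)

  IsBPrime-standard-unique : ∀ X X′ → IsBPrime A origin C X → IsBPrime A origin C X′ → X ≡ X′
  IsBPrime-standard-unique (x , y) (x′ , y′) (∠X , distX , minX) (∠X′ , distX′ , minX′)
    with height-one (x , y) ∠X distX | height-one (x′ , y′) ∠X′ distX′
  ... | refl | refl = cong₂ _,_ (distA-injective x x′ (InAngle⇒above x ∠X) (InAngle⇒above x′ ∠X′)
                            (ℕP.≤-antisym (minX (x′ , 1ℤ) ∠X′ distX′) (minX′ (x , 1ℤ) ∠X distX))) refl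

  -- B′ = (x₀ , 1) with x₀ = ⌈a / M⌉, so that M x₀ - a is the remainder of -a modulo M.
  IsBPrime-standard : Σ ℤ λ x₀ → IsBPrime A origin C (x₀ , 1ℤ)
  IsBPrime-standard = x₀ , above⇒InAngle x₀ a≤Mx₀ , intDist-axis l (x₀ , 1ℤ) , minimal
    where
    t = (- a) ℤDM./ℕ suc m
    r = (- a) ℤDM.%ℕ suc m
    division : - a ≡ + r + t * M
    division = ℤDM.a≡a%ℕn+[a/ℕn]*n (- a) (suc m)
    x₀ = - t
    excess₀ : M * x₀ - a ≡ + r
    excess₀ = trans (expand M t a) (trans (cong (_- t * M) division) (cancel (+ r) t M))
      where
      expand : ∀ M t a → M * (- t) - a ≡ (- a) - t * M
      expand = solve-∀
      cancel : ∀ r t M → (r + t * M) - t * M ≡ r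
      cancel = solve-∀
    a≤Mx₀ : a ≤ℤ M * x₀
    a≤Mx₀ = ℤP.0≤i-j⇒j≤i (subst (0ℤ ≤ℤ_) (sym excess₀) (+≤+ z≤n))
    minimal : ∀ Y → InAngle A origin C Y → intDist Y origin C ≡ 1 → distA x₀ ≤ intDist Y origin A
    minimal (y , y₂) ∠Y distY with height-one (y , y₂) ∠Y distY
    ... | refl = subst₂ _≤_ (sym (distA-unfold x₀)) (sym (distA-unfold y))
                   (div₀-monoˡ-≤ (vlength A) (ℤP.drop‿+≤+ excess₀≤excess))
      where
      a≤My = InAngle⇒above y ∠Y
      excess-y : M * y - a ≡ M * (y + t) + + r
      excess-y = trans (cong (λ z → M * y + z) division) (regroup M y t (+ r))
        where
        regroup : ∀ M y t r → M * y + (r + t * M) ≡ M * (y + t) + r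
        regroup = solve-∀
      0≤y+t : 0ℤ ≤ℤ y + t
      0≤y+t = nonNeg-quotient m r (y + t) (ℤDM.n%ℕd<d (- a) (suc m)) (subst (0ℤ ≤ℤ_) excess-y (ℤP.i≤j⇒0≤j-i a≤My))
      excess₀≤excess : + ∣ M * x₀ - a ∣ ≤ℤ + ∣ M * y - a ∣
      excess₀≤excess = begin
        + ∣ M * x₀ - a ∣        ≡⟨ trans (excess≡ x₀ a≤Mx₀) excess₀ ⟩
        + r                     ≤⟨ ℤP.i≤j+i (+ r) (M * (y + t)) {{nonNegative (subst (_≤ℤ M * (y + t)) (ℤP.*-zeroʳ M) (ℤP.*-monoˡ-≤-nonNeg M 0≤y+t))}} ⟩
        M * (y + t) + + r       ≡⟨ excess-y ⟨
        M * y - a               ≡⟨ excess≡ y a≤My ⟨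
        + ∣ M * y - a ∣         ∎
        where open ℤP.≤-Reasoning

orient≢0-reverse : ∀ A B C → ¬ orient A B C ≡ 0ℤ → ¬ orient C B A ≡ 0ℤ
orient≢0-reverse A B C = det≢0-negate (vec B A) (vec B C)

module _ {A B C : Point} (sp : StandardPosition A B C) where
  open StandardPosition sp

  IsBPrime-to-standard : ∀ X → IsBPrime A B C X → IsBPrime (upper a m) origin (onAxis l) (apply map X)
  IsBPrime-to-standard X bp = subst₃ (λ A′ B′ C′ → IsBPrime A′ B′ C′ (apply map X)) map-A map-B map-C
    (IsBPrime-apply map A B C X bp)

  IsBPrime-from-standard : ∀ X → IsBPrime (upper a m) origin (onAxis l) X → IsBPrime A B C (apply (inverse map) X)
  IsBPrime-from-standard X bp = subst₃ (λ A′ B′ C′ → IsBPrime A′ B′ C′ (apply (inverse map) X))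
    (back map-A) (back map-B) (back map-C) (IsBPrime-apply (inverse map) (upper a m) origin (onAxis l) X bp)
    where
    back : ∀ {P Q} → apply map P ≡ Q → apply (inverse map) Q ≡ P
    back {P} eq = trans (cong (apply (inverse map)) (sym eq)) (apply-inverseˡ map P)

IsBPrime-unique : ∀ A B C {X X′} → ¬ orient A B C ≡ 0ℤ → IsBPrime A B C X → IsBPrime A B C X′ → X ≡ X′
IsBPrime-unique A B C {X} {X′} nz bp bp′ = apply-injective map
  (IsBPrime-standard-unique a m l (apply map X) (apply map X′) (IsBPrime-to-standard sp X bp) (IsBPrime-to-standard sp X′ bp′))
  where
  sp = standardPosition A B C (orient≢0-reverse A B C nz)
  open StandardPosition sp

IsBPrime-exists : ∀ A B C → ¬ orient A B C ≡ 0ℤ → Σ Point (IsBPrime A B C)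
IsBPrime-exists A B C nz = apply (inverse map) X₀ , IsBPrime-from-standard sp X₀ (proj₂ (IsBPrime-standard a m l))
  where
  sp = standardPosition A B C (orient≢0-reverse A B C nz)
  open StandardPosition sp
  X₀ = (proj₁ (IsBPrime-standard a m l) , 1ℤ)

IsCPrime-unique : ∀ B C D {Y Y′} → ¬ orient B C D ≡ 0ℤ → IsCPrime B C D Y → IsCPrime B C D Y′ → Y ≡ Y′
IsCPrime-unique B C D {Y} {Y′} nz cp cp′ =
  IsBPrime-unique D C B (orient≢0-reverse B C D nz) (IsCPrime⇒IsBPrime B C D Y cp) (IsCPrime⇒IsBPrime B C D Y′ cp′)

IsCPrime-exists : ∀ B C D → ¬ orient B C D ≡ 0ℤ → Σ Point (IsCPrime B C D)
IsCPrime-exists B C D nz = C′ , IsBPrime⇒IsCPrime B C D C′ (proj₂ B′-of-DCB)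
  where
  B′-of-DCB = IsBPrime-exists D C B (orient≢0-reverse B C D nz)
  C′ = proj₁ B′-of-DCB

sg : ℤ → ℤ
sg +0       = 0ℤ
sg +[1+ _ ] = 1ℤ
sg -[1+ _ ] = -1ℤ

sgnDot≡sg-dot : ∀ u w → sgnDot u w ≡ sg (dot u w)
sgnDot≡sg-dot u w with dot u w
... | +0       = refl
... | +[1+ _ ] = refl
... | -[1+ _ ] = refl

sg-*-pos : ∀ P x → 0ℤ <ℤ P → sg (P * x) ≡ sg x
sg-*-pos +[1+ p ] +0       _ = cong sg (ℤP.*-zeroʳ +[1+ p ])
sg-*-pos +[1+ p ] +[1+ n ] _ = refl
sg-*-pos +[1+ p ] -[1+ n ] _ = refl
sg-*-pos +0       _        (+<+ ())

sg*abs : ∀ x → sg x * + ∣ x ∣ ≡ x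
sg*abs +0       = refl
sg*abs +[1+ n ] = ℤP.*-identityˡ +[1+ n ]
sg*abs -[1+ n ] = ℤP.-1*i≡-i +[1+ n ]

0≤i*i : ∀ i → 0ℤ ≤ℤ i * i
0≤i*i +0       = +≤+ z≤n
0≤i*i +[1+ n ] = +≤+ z≤n
0≤i*i -[1+ n ] = +≤+ z≤n

0<i*i : ∀ i → ¬ i ≡ 0ℤ → 0ℤ <ℤ i * i
0<i*i +0       i≢0 = ⊥-elim (i≢0 refl)
0<i*i +[1+ n ] _   = +<+ (s≤s z≤n)
0<i*i -[1+ n ] _   = +<+ (s≤s z≤n)

0<dot-self : ∀ v → ¬ v ≡ (0ℤ , 0ℤ) → 0ℤ <ℤ dot v v
0<dot-self (+0 , y) v≢0 = subst (0ℤ <ℤ_) (sym (ℤP.+-identityˡ (y * y))) (0<i*i y (λ y≡0 → v≢0 (cong₂ _,_ refl y≡0)))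
0<dot-self (x@(+[1+ _ ]) , y) _ = ℤP.<-≤-trans (0<i*i x (λ ())) (ℤP.i≤i+j (x * x) (y * y) {{nonNegative (0≤i*i y)}})
0<dot-self (x@(-[1+ _ ]) , y) _ = ℤP.<-≤-trans (0<i*i x (λ ())) (ℤP.i≤i+j (x * x) (y * y) {{nonNegative (0≤i*i y)}})

-- For parallel v, w the products ⟨v,v⟩ w and ⟨v,w⟩ v agree, hence so do their images under g.
dot-self*dot-linear : ∀ g v w → det v w ≡ 0ℤ → dot v v * dot (linear g v) (linear g w) ≡ dot v w * dot (linear g v) (linear g v)
dot-self*dot-linear g v w parallel = begin
  dot v v * dot (linear g v) (linear g w)   ≡⟨ dot-·ᵥ (linear g v) (dot v v) (linear g w) ⟨
  dot (linear g v) (dot v v ·ᵥ linear g w)  ≡⟨ cong (dot (linear g v)) (linear-·ᵥ g (dot v v) w) ⟩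
  dot (linear g v) (linear g (dot v v ·ᵥ w)) ≡⟨ cong (λ u → dot (linear g v) (linear g u)) (parallel-identity v w parallel) ⟩
  dot (linear g v) (linear g (dot v w ·ᵥ v)) ≡⟨ cong (dot (linear g v)) (linear-·ᵥ g (dot v w) v) ⟨
  dot (linear g v) (dot v w ·ᵥ linear g v)  ≡⟨ dot-·ᵥ (linear g v) (dot v w) (linear g v) ⟩
  dot v w * dot (linear g v) (linear g v)   ∎
  where
  open ≡-Reasoning
  dot-·ᵥ : ∀ u k w → dot u (k ·ᵥ w) ≡ k * dot u w
  dot-·ᵥ (u₁ , u₂) k (w₁ , w₂) = expand
    where
    expand : u₁ * (k * w₁) + u₂ * (k * w₂) ≡ k * (u₁ * w₁ + u₂ * w₂)
    expand = solve (u₁ ∷ u₂ ∷ k ∷ w₁ ∷ w₂ ∷ [])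
  parallel-identity : ∀ v w → det v w ≡ 0ℤ → dot v v ·ᵥ w ≡ dot v w ·ᵥ v
  parallel-identity (v₁ , v₂) (w₁ , w₂) d≡0 = cong₂ _,_
    (trans (expand₁ v₁ v₂ w₁ w₂) (trans (cong (λ z → (v₁ * w₁ + v₂ * w₂) * v₁ + z * - v₂) d≡0) (ℤP.+-identityʳ _)))
    (trans (expand₂ v₁ v₂ w₁ w₂) (trans (cong (λ z → (v₁ * w₁ + v₂ * w₂) * v₂ + z * v₁) d≡0) (ℤP.+-identityʳ _)))
    where
    expand₁ : ∀ v₁ v₂ w₁ w₂ → (v₁ * v₁ + v₂ * v₂) * w₁ ≡ (v₁ * w₁ + v₂ * w₂) * v₁ + (v₁ * w₂ - v₂ * w₁) * - v₂
    expand₁ = solve-∀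
    expand₂ : ∀ v₁ v₂ w₁ w₂ → (v₁ * v₁ + v₂ * v₂) * w₂ ≡ (v₁ * w₁ + v₂ * w₂) * v₂ + (v₁ * w₂ - v₂ * w₁) * v₁
    expand₂ = solve-∀

vec-self : ∀ P → vec P P ≡ (0ℤ , 0ℤ)
vec-self (x , y) = cong₂ _,_ (ℤP.+-inverseʳ x) (ℤP.+-inverseʳ y)

vec≢0-apply : ∀ g B C → ¬ vec B C ≡ (0ℤ , 0ℤ) → ¬ vec (apply g B) (apply g C) ≡ (0ℤ , 0ℤ)
vec≢0-apply g B C BC≢0 gBC≡0 = BC≢0 (subst (λ Z → vec B Z ≡ (0ℤ , 0ℤ)) (sym C≡B) (vec-self B))
  where
  C≡B : C ≡ B
  C≡B = apply-injective g (vec-injective (apply g B) (trans gBC≡0 (sym (vec-self (apply g B)))))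

sgnDot-apply : ∀ g B C X Y → det (vec B C) (vec X Y) ≡ 0ℤ → ¬ vec B C ≡ (0ℤ , 0ℤ) →
               sgnDot (vec (apply g B) (apply g C)) (vec (apply g X) (apply g Y)) ≡ sgnDot (vec B C) (vec X Y)
sgnDot-apply g B C X Y parallel BC≢0 = begin
  sgnDot (vec (apply g B) (apply g C)) (vec (apply g X) (apply g Y)) ≡⟨ cong₂ sgnDot (vec-apply g B C) (vec-apply g X Y) ⟩
  sgnDot (linear g v) (linear g w)       ≡⟨ sgnDot≡sg-dot (linear g v) (linear g w) ⟩
  sg (dot (linear g v) (linear g w))     ≡⟨ sg-*-pos (dot v v) _ (0<dot-self v BC≢0) ⟨
  sg (dot v v * dot (linear g v) (linear g w)) ≡⟨ cong sg (dot-self*dot-linear g v w parallel) ⟩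
  sg (dot v w * dot (linear g v) (linear g v)) ≡⟨ cong sg (ℤP.*-comm (dot v w) _) ⟩
  sg (dot (linear g v) (linear g v) * dot v w) ≡⟨ sg-*-pos _ (dot v w) (0<dot-self (linear g v) gv≢0) ⟩
  sg (dot v w)                           ≡⟨ sgnDot≡sg-dot v w ⟨
  sgnDot v w                             ∎
  where
  open ≡-Reasoning
  v = vec B C
  w = vec X Y
  gv≢0 : ¬ linear g v ≡ (0ℤ , 0ℤ)
  gv≢0 = subst (λ u → ¬ u ≡ (0ℤ , 0ℤ)) (vec-apply g B C) (vec≢0-apply g B C BC≢0)

orient≢0⇒vec≢0 : ∀ A B C → ¬ orient A B C ≡ 0ℤ → ¬ vec B C ≡ (0ℤ , 0ℤ)
orient≢0⇒vec≢0 A B C nz BC≡0 = nz (trans (cong (det (vec B A)) BC≡0) (vanish (proj₁ (vec B A)) (proj₂ (vec B A))))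
  where
  vanish : ∀ x y → x * 0ℤ - y * 0ℤ ≡ 0ℤ
  vanish = solve-∀

level-det : ∀ l P Q → proj₂ P ≡ 1ℤ → proj₂ Q ≡ 1ℤ → det (vec origin (onAxis l)) (vec P Q) ≡ 0ℤ
level-det l (p , .1ℤ) (q , .1ℤ) refl refl = vanish +[1+ l ] p q
  where
  vanish : ∀ L p q → (L - 0ℤ) * (1ℤ - 1ℤ) - (0ℤ - 0ℤ) * (q - p) ≡ 0ℤ
  vanish = solve-∀

level-signed-length : ∀ l P Q → proj₂ P ≡ 1ℤ → proj₂ Q ≡ 1ℤ →
                      sgnDot (vec origin (onAxis l)) (vec P Q) * + intLength P Q ≡ proj₁ Q - proj₁ P
level-signed-length l (p , .1ℤ) (q , .1ℤ) refl refl = begin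
  sgnDot (vec origin (onAxis l)) (vec (p , 1ℤ) (q , 1ℤ)) * + intLength (p , 1ℤ) (q , 1ℤ)
    ≡⟨ cong₂ _*_ (sgnDot≡sg-dot (vec origin (onAxis l)) (vec (p , 1ℤ) (q , 1ℤ))) (cong +_ (gcd-identityʳ ∣ q - p ∣)) ⟩
  sg (dot (vec origin (onAxis l)) (vec (p , 1ℤ) (q , 1ℤ))) * + ∣ q - p ∣
    ≡⟨ cong (λ z → sg z * + ∣ q - p ∣) (expand +[1+ l ] p q) ⟩
  sg (+[1+ l ] * (q - p)) * + ∣ q - p ∣  ≡⟨ cong (_* + ∣ q - p ∣) (sg-*-pos +[1+ l ] (q - p) (+<+ (s≤s z≤n))) ⟩
  sg (q - p) * + ∣ q - p ∣               ≡⟨ sg*abs (q - p) ⟩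
  q - p                                 ∎
  where
  open ≡-Reasoning
  expand : ∀ L p q → (L - 0ℤ) * (q - p) + (0ℤ - 0ℤ) * (1ℤ - 1ℤ) ≡ L * (q - p)
  expand = solve-∀

-- In standard position the first angle is clockwise, so local convexity puts D above the x-axis.
Convex₂-standard⇒above : ∀ a m l D → Convex₂ (upper a m) origin (onAxis l) D → Σ ℤ λ d → Σ ℕ λ k → D ≡ (d , +[1+ k ])
Convex₂-standard⇒above a m l (d₁ , d₂) (inj₁ (clockwise , _)) = ⊥-elim (counterclockwise (subst (0ℤ <ℤ_) orient-A₀ clockwise))
  where
  orient-A₀ : orient (upper a m) origin (onAxis l) ≡ - (+[1+ m ] * +[1+ l ])
  orient-A₀ = trans (cong₂ det (vec-origin (upper a m)) (vec-origin (onAxis l))) (expand a +[1+ m ] +[1+ l ])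
    where
    expand : ∀ a M L → a * 0ℤ - M * L ≡ - (M * L)
    expand = solve-∀
  counterclockwise : ¬ 0ℤ <ℤ - (+[1+ m ] * +[1+ l ])
  counterclockwise ()
Convex₂-standard⇒above a m l (d₁ , d₂) (inj₂ (_ , clockwise)) = d₁ , above d₂ (subst (_<ℤ 0ℤ) (expand +[1+ l ] d₁ d₂) clockwise)
  where
  expand : ∀ L d₁ d₂ → (0ℤ - L) * (d₂ - 0ℤ) - (0ℤ - 0ℤ) * (d₁ - L) ≡ - (L * d₂)
  expand = solve-∀
  above : ∀ d₂ → - (+[1+ l ] * d₂) <ℤ 0ℤ → Σ ℕ λ k → (d₁ , d₂) ≡ (d₁ , +[1+ k ])
  above +[1+ k ] _ = k , refl
  above +0       p = ⊥-elim (ℤP.<-irrefl refl (subst (_<ℤ 0ℤ) (cong -_ (ℤP.*-zeroʳ +[1+ l ])) p))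
  above -[1+ k ] (+<+ ())

-- In standard position B′ and C′ both lie on the line y = 1, so B′C′ is parallel to BC and the signed
-- integer length of B′C′ is the difference of their abscissas.
module StandardChord {A B C D X Y : Point} (sp : StandardPosition A B C) (convex : Convex₂ A B C D)
                     (bp : IsBPrime A B C X) (cp : IsCPrime B C D Y) where
  open StandardPosition sp

  private
    F = map
    D₀ = apply F D
    Y₀ = apply F Y
    convex₀ : Convex₂ (upper a m) origin (onAxis l) D₀
    convex₀ = subst₃ (λ A′ B′ C′ → Convex₂ A′ B′ C′ D₀) map-A map-B map-C (Convex₂-apply F A B C D convex)
    cp₀ : IsCPrime origin (onAxis l) D₀ Y₀
    cp₀ = subst₂ (λ B′ C′ → IsCPrime B′ C′ D₀ Y₀) map-B map-C (IsCPrime-apply F B C D Y cp)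

  D-above : Σ ℤ λ d → Σ ℕ λ k → D₀ ≡ (d , +[1+ k ])
  D-above = Convex₂-standard⇒above a m l D₀ convex₀

  height-X : proj₂ (apply F X) ≡ 1ℤ
  height-X = height-one a m l (apply F X) (proj₁ bp₀) (proj₁ (proj₂ bp₀))
    where bp₀ = IsBPrime-to-standard sp X bp

  height-Y : proj₂ Y₀ ≡ 1ℤ
  height-Y = InAngle-height 0ℤ 0 +[1+ l ] d (suc k) Y₀
    (subst (λ D′ → InAngle origin (onAxis l) D′ Y₀) D₀≡ (proj₁ cp₀)) (trans (sym (intDist-axis l Y₀)) (proj₁ (proj₂ cp₀)))
    where
    d = proj₁ D-above
    k = proj₁ (proj₂ D-above)
    D₀≡ = proj₂ (proj₂ D-above)

  parallel : det (vec B C) (vec X Y) ≡ 0ℤ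
  parallel = unit*i≡0⇒i≡0 (linearDet-unit F) _ (begin
    linearDet F * det (vec B C) (vec X Y)          ≡⟨ det-linear F (vec B C) (vec X Y) ⟨
    det (linear F (vec B C)) (linear F (vec X Y))  ≡⟨ cong₂ det (vec-apply F B C) (vec-apply F X Y) ⟨
    det (vec (apply F B) (apply F C)) (vec (apply F X) Y₀) ≡⟨ cong₂ (λ P Q → det (vec P Q) (vec (apply F X) Y₀)) map-B map-C ⟩
    det (vec origin (onAxis l)) (vec (apply F X) Y₀) ≡⟨ level-det l (apply F X) Y₀ height-X height-Y ⟩
    0ℤ ∎)
    where open ≡-Reasoning

  signed-chord : sgnDot (vec B C) (vec X Y) * + intLength X Y ≡ proj₁ Y₀ - proj₁ (apply F X)
  signed-chord = begin
    sgnDot (vec B C) (vec X Y) * + intLength X Y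
      ≡⟨ cong₂ (λ s n → s * + n) (sgnDot-apply F B C X Y parallel BC≢0) (intLength-apply F X Y) ⟨
    sgnDot (vec (apply F B) (apply F C)) (vec (apply F X) Y₀) * + intLength (apply F X) Y₀
      ≡⟨ cong₂ (λ P Q → sgnDot (vec P Q) (vec (apply F X) Y₀) * + intLength (apply F X) Y₀) map-B map-C ⟩
    sgnDot (vec origin (onAxis l)) (vec (apply F X) Y₀) * + intLength (apply F X) Y₀
      ≡⟨ level-signed-length l (apply F X) Y₀ height-X height-Y ⟩
    proj₁ Y₀ - proj₁ (apply F X) ∎
    where
    open ≡-Reasoning
    BC≢0 : ¬ vec B C ≡ (0ℤ , 0ℤ)
    BC≢0 = orient≢0⇒vec≢0 A B C (SameSign⇒≢0ˡ convex)

chordValue : Point → Point → Point → Point → ℤ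
chordValue B C X Y = + intLength B C - sgnDot (vec B C) (vec X Y) * + intLength X Y - + 2

chord-parallel : ∀ {A B C D X Y} → Convex₂ A B C D → IsBPrime A B C X → IsCPrime B C D Y →
                 det (vec B C) (vec X Y) ≡ 0ℤ
chord-parallel {A} {B} {C} {D} {X} {Y} convex =
  StandardChord.parallel {A} {B} {C} {D} {X} {Y} (standardPosition A B C (orient≢0-reverse A B C (SameSign⇒≢0ˡ convex))) convex

chordValue-apply : ∀ g {A B C D X Y} → Convex₂ A B C D → IsBPrime A B C X → IsCPrime B C D Y →
                   chordValue (apply g B) (apply g C) (apply g X) (apply g Y) ≡ chordValue B C X Y
chordValue-apply g {A} {B} {C} {D} {X} {Y} convex bp cp = cong₂ (λ n s → + n - s - + 2) (intLength-apply g B C)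
  (cong₂ (λ s n → s * + n) (sgnDot-apply g B C X Y (chord-parallel {A} {B} {C} {D} {X} {Y} convex bp cp) (orient≢0⇒vec≢0 A B C (SameSign⇒≢0ˡ convex)))
                           (intLength-apply g X Y))

ChordCurv-apply : ∀ g {A B C D k} → Convex₂ A B C D → ChordCurv A B C D k →
                  ChordCurv (apply g A) (apply g B) (apply g C) (apply g D) k
ChordCurv-apply g {A} {B} {C} {D} convex (X , Y , bp , cp , k≡) =
  apply g X , apply g Y , IsBPrime-apply g A B C X bp , IsCPrime-apply g B C D Y cp ,
  trans k≡ (sym (chordValue-apply g {A} {B} {C} {D} {X} {Y} convex bp cp))

ChordCurv-exists : ∀ A B C D → Convex₂ A B C D → Σ ℤ (ChordCurv A B C D)
ChordCurv-exists A B C D convex = chordValue B C X Y , X , Y , bp , cp , refl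
  where
  X = proj₁ (IsBPrime-exists A B C (SameSign⇒≢0ˡ convex))
  bp = proj₂ (IsBPrime-exists A B C (SameSign⇒≢0ˡ convex))
  Y = proj₁ (IsCPrime-exists B C D (SameSign⇒≢0ʳ convex))
  cp = proj₂ (IsCPrime-exists B C D (SameSign⇒≢0ʳ convex))

-- Given B′, the chord curvature fixes the signed length of the chord B′C′ along BC, hence C′.
IsCPrime-determined : ∀ {A B C D D′ X Y Y′} → Convex₂ A B C D → Convex₂ A B C D′ →
  IsBPrime A B C X → IsCPrime B C D Y → IsCPrime B C D′ Y′ → chordValue B C X Y ≡ chordValue B C X Y′ → Y ≡ Y′
IsCPrime-determined {A} {B} {C} {D} {D′} {X} {Y} {Y′} convex convex′ bp cp cp′ same = apply-injective map (cong₂ _,_ first second)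
  where
  sp = standardPosition A B C (orient≢0-reverse A B C (SameSign⇒≢0ˡ convex))
  open StandardPosition sp
  module Chord = StandardChord {A} {B} {C} {D} {X} {Y} sp convex bp cp
  module Chord′ = StandardChord {A} {B} {C} {D′} {X} {Y′} sp convex′ bp cp′
  signed-lengths : sgnDot (vec B C) (vec X Y) * + intLength X Y ≡ sgnDot (vec B C) (vec X Y′) * + intLength X Y′
  signed-lengths = cancel (+ intLength B C) _ _ same
    where
    cancel : ∀ n s s′ → n - s - + 2 ≡ n - s′ - + 2 → s ≡ s′
    cancel n s s′ eq = trans (sym (recover n s)) (trans (cong (λ z → n - z - + 2) eq) (recover n s′))
      where
      recover : ∀ n s → n - (n - s - + 2) - + 2 ≡ s
      recover = solve-∀
  first : proj₁ (apply map Y) ≡ proj₁ (apply map Y′)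
  first = trans (sym (shift _ _)) (trans (cong (_+ proj₁ (apply map X)) differences) (shift _ _))
    where
    differences : proj₁ (apply map Y) - proj₁ (apply map X) ≡ proj₁ (apply map Y′) - proj₁ (apply map X)
    differences = trans (sym Chord.signed-chord) (trans signed-lengths Chord′.signed-chord)
    shift : ∀ y x → (y - x) + x ≡ y
    shift = solve-∀
  second : proj₂ (apply map Y) ≡ proj₂ (apply map Y′)
  second = trans Chord.height-Y (sym Chord′.height-Y)

-- The congruence h of the angles at C agrees with g on B, C and on the point C′ of BCD, which is off the line BC.
extend : ∀ g {A B C D A′ B′ C′ D′ k} → Convex₂ A B C D → Convex₂ A′ B′ C′ D′ →
  apply g A ≡ A′ → apply g B ≡ B′ → apply g C ≡ C′ →
  AngleCong B C D B′ C′ D′ → intLength B C ≡ intLength B′ C′ → intLength C D ≡ intLength C′ D′ →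
  ChordCurv A B C D k → ChordCurv A′ B′ C′ D′ k → apply g D ≡ D′
extend g {A} {B} {C} {D} {D′ = D′} convex convex′ refl refl refl (h , hC , rayB , rayD) sameBC sameCD
       (X , Y , bp , cp , k≡) (X′ , Y′ , bp′ , cp′ , k≡′) =
  trans (agree-on-triangle g h B C Y (sym hB) (sym hC) (trans gY≡Y′ (sym hY≡Y′)) (intDist≡1⇒nondegenerate Y B C (proj₁ (proj₂ cp))) D) hD
  where
  hB : apply h B ≡ apply g B
  hB = ray-point h B C (apply g B) (apply g C) hC rayB
         (trans (intLength-sym C B) (trans sameBC (intLength-sym (apply g B) (apply g C))))
  hD : apply h D ≡ D′
  hD = ray-point h D C D′ (apply g C) hC rayD sameCD
  gX≡X′ : apply g X ≡ X′
  gX≡X′ = IsBPrime-unique (apply g A) (apply g B) (apply g C) (SameSign⇒≢0ˡ convex′) (IsBPrime-apply g A B C X bp) bp′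
  gY≡Y′ : apply g Y ≡ Y′
  gY≡Y′ = IsCPrime-determined {apply g A} {apply g B} {apply g C} {apply g D} {D′} {apply g X} {apply g Y} {Y′}
    (Convex₂-apply g A B C D convex) convex′ (IsBPrime-apply g A B C X bp) (IsCPrime-apply g B C D Y cp)
    cp′ (trans (chordValue-apply g {A} {B} {C} {D} {X} {Y} convex bp cp)
          (trans (sym k≡) (trans k≡′ (cong (λ Z → chordValue (apply g B) (apply g C) Z Y′) (sym gX≡X′)))))
  hY≡Y′ : apply h Y ≡ Y′
  hY≡Y′ = IsCPrime-unique (apply g B) (apply g C) D′ (SameSign⇒≢0ʳ convex′)
    (subst₃ (λ P Q R → IsCPrime P Q R (apply h Y)) hB hC hD (IsCPrime-apply h B C D Y cp)) cp′

congruent⇒AngleCong : ∀ g {A B C A′ B′ C′} → apply g A ≡ A′ → apply g B ≡ B′ → apply g C ≡ C′ → AngleCong A B C A′ B′ C′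
congruent⇒AngleCong g {A} {B} {C} refl refl refl = g , refl , SameDir-refl (vec (apply g B) (apply g A)) , SameDir-refl (vec (apply g B) (apply g C))

congruent⇒same-intLength : ∀ g {A B A′ B′} → apply g A ≡ A′ → apply g B ≡ B′ → intLength A B ≡ intLength A′ B′
congruent⇒same-intLength g {A} {B} refl refl = sym (intLength-apply g A B)

SameChordCurv : Point → Point → Point → Point → Point → Point → Point → Point → Set
SameChordCurv A B C D A′ B′ C′ D′ = Σ ℤ λ k → ChordCurv A B C D k × ChordCurv A′ B′ C′ D′ k

congruent⇒SameChordCurv : ∀ g {A B C D A′ B′ C′ D′} → Convex₂ A B C D →
  apply g A ≡ A′ → apply g B ≡ B′ → apply g C ≡ C′ → apply g D ≡ D′ → SameChordCurv A B C D A′ B′ C′ D′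
congruent⇒SameChordCurv g {A} {B} {C} {D} convex refl refl refl refl =
  k , curv , ChordCurv-apply g {A} {B} {C} {D} convex curv
  where
  k = proj₁ (ChordCurv-exists A B C D convex)
  curv = proj₂ (ChordCurv-exists A B C D convex)

AngleCong⇒congruent : ∀ {A B C A′ B′ C′} → AngleCong A B C A′ B′ C′ →
  intLength A B ≡ intLength A′ B′ → intLength B C ≡ intLength B′ C′ →
  Σ IntAffine λ g → apply g A ≡ A′ × apply g B ≡ B′ × apply g C ≡ C′
AngleCong⇒congruent {A} {B} {C} {A′} {B′} {C′} (g , gB , rayA , rayC) sameAB sameBC =
  g , ray-point g A B A′ B′ gB rayA (trans (intLength-sym B A) (trans sameAB (intLength-sym A′ B′))) ,
  gB , ray-point g C B C′ B′ gB rayC sameBC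

-- The data at A_t, …, A_{t+3} that lets `extend` pass from A_{t+2} to A_{t+3}.
record Matching (P P′ : ℕ → Point) (t : ℕ) : Set where
  field
    convex    : Convex₂ (P t) (P (suc t)) (P (suc (suc t))) (P (suc (suc (suc t))))
    convex′   : Convex₂ (P′ t) (P′ (suc t)) (P′ (suc (suc t))) (P′ (suc (suc (suc t))))
    angle     : AngleCong (P (suc t)) (P (suc (suc t))) (P (suc (suc (suc t))))
                          (P′ (suc t)) (P′ (suc (suc t))) (P′ (suc (suc (suc t))))
    length₁   : intLength (P (suc t)) (P (suc (suc t))) ≡ intLength (P′ (suc t)) (P′ (suc (suc t)))
    length₂   : intLength (P (suc (suc t))) (P (suc (suc (suc t)))) ≡ intLength (P′ (suc (suc t))) (P′ (suc (suc (suc t))))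
    curvature : SameChordCurv (P t) (P (suc t)) (P (suc (suc t))) (P (suc (suc (suc t))))
                              (P′ t) (P′ (suc t)) (P′ (suc (suc t))) (P′ (suc (suc (suc t))))

propagate : ∀ g (P P′ : ℕ → Point) N → (∀ t → 3 ℕ.+ t ≤ N → Matching P P′ t) →
  apply g (P 0) ≡ P′ 0 → apply g (P 1) ≡ P′ 1 → apply g (P 2) ≡ P′ 2 → ∀ j → j ≤ N → apply g (P j) ≡ P′ j
propagate g P P′ N matching g₀ g₁ g₂ = go
  where
  go : ∀ j → j ≤ N → apply g (P j) ≡ P′ j
  go 0 _ = g₀
  go 1 _ = g₁
  go 2 _ = g₂
  go (suc (suc (suc t))) t+3≤N =
    extend g convex convex′ (go t (ℕP.m+n≤o⇒n≤o 3 t+3≤N)) (go (suc t) (ℕP.m+n≤o⇒n≤o 2 t+3≤N))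
      (go (suc (suc t)) (ℕP.m+n≤o⇒n≤o 1 t+3≤N)) angle length₁ length₂ (proj₁ (proj₂ curvature)) (proj₂ (proj₂ curvature))
    where open Matching (matching t t+3≤N)

LocallyConvexBL⇒Convex₂ : ∀ n A → LocallyConvexBL n A → ∀ i → 1 ≤ i → suc i ≤ n →
  Convex₂ (A (pred i)) (A i) (A (suc i)) (A (suc (suc i)))
LocallyConvexBL⇒Convex₂ n A (inj₁ positive) i 1≤i i<n = inj₁ (positive i 1≤i (ℕP.<⇒≤ i<n) , positive (suc i) (s≤s z≤n) i<n)
LocallyConvexBL⇒Convex₂ n A (inj₂ negative) i 1≤i i<n = inj₂ (negative i 1≤i (ℕP.<⇒≤ i<n) , negative (suc i) (s≤s z≤n) i<n)

module _ (n : ℕ) (1≤n : 1 ≤ n) (A A′ : BrokenLine) where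

  IntCongruentBL⇒invariants : LocallyConvexBL n A → IntCongruentBL n A A′ → SameAngleCurvBL n A A′ × SameLengthsBL n A A′
  IntCongruentBL⇒invariants convexA (g , gA) = (angles , curvatures) , lengths
    where
    ≤n+1 : ∀ {i} → i ≤ n → i ≤ n ℕ.+ 1
    ≤n+1 i≤n = ℕP.m≤n⇒m≤n+o 1 i≤n
    <n+1 : ∀ {i} → i ≤ n → suc i ≤ n ℕ.+ 1
    <n+1 {i} i≤n = subst (suc i ≤_) (ℕP.+-comm 1 n) (s≤s i≤n)
    gA-pred : ∀ {i} → i ≤ n → apply g (A (pred i)) ≡ A′ (pred i)
    gA-pred {i} i≤n = gA (pred i) (≤n+1 (ℕP.≤-trans ℕP.pred[n]≤n i≤n))
    angles : ∀ i → 1 ≤ i → i ≤ n → AngleCong (A (pred i)) (A i) (A (suc i)) (A′ (pred i)) (A′ i) (A′ (suc i))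
    angles i _ i≤n = congruent⇒AngleCong g (gA-pred i≤n) (gA i (≤n+1 i≤n)) (gA (suc i) (<n+1 i≤n))
    curvatures : ∀ i → 1 ≤ i → i ≤ pred n →
      SameChordCurv (A (pred i)) (A i) (A (suc i)) (A (suc (suc i))) (A′ (pred i)) (A′ i) (A′ (suc i)) (A′ (suc (suc i)))
    curvatures i 1≤i i≤n-1 = congruent⇒SameChordCurv g (LocallyConvexBL⇒Convex₂ n A convexA i 1≤i i<n)
      (gA-pred i≤n) (gA i (≤n+1 i≤n)) (gA (suc i) (≤n+1 i<n)) (gA (suc (suc i)) (<n+1 i<n))
      where
      i<n : suc i ≤ n
      i<n = subst (suc i ≤_) (ℕP.suc-pred n {{ℕ.>-nonZero 1≤n}}) (s≤s i≤n-1)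
      i≤n = ℕP.<⇒≤ i<n
    lengths : SameLengthsBL n A A′
    lengths i i≤n = congruent⇒same-intLength g (gA i (≤n+1 i≤n)) (gA (suc i) (<n+1 i≤n))

  invariants⇒IntCongruentBL : LocallyConvexBL n A → LocallyConvexBL n A′ →
                              SameAngleCurvBL n A A′ × SameLengthsBL n A A′ → IntCongruentBL n A A′
  invariants⇒IntCongruentBL convexA convexA′ ((angles , curvatures) , lengths) =
    g , propagate g A A′ (n ℕ.+ 1) matching g₀ g₁ g₂
    where
    start = AngleCong⇒congruent (angles 1 ℕP.≤-refl 1≤n) (lengths 0 z≤n) (lengths 1 1≤n)
    g = proj₁ start
    g₀ = proj₁ (proj₂ start)
    g₁ = proj₁ (proj₂ (proj₂ start))
    g₂ = proj₂ (proj₂ (proj₂ start))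
    matching : ∀ t → 3 ℕ.+ t ≤ n ℕ.+ 1 → Matching A A′ t
    matching t t+3≤n+1 = record
      { convex = LocallyConvexBL⇒Convex₂ n A convexA (suc t) (s≤s z≤n) t+2≤n
      ; convex′ = LocallyConvexBL⇒Convex₂ n A′ convexA′ (suc t) (s≤s z≤n) t+2≤n
      ; angle = angles (suc (suc t)) (s≤s z≤n) t+2≤n
      ; length₁ = lengths (suc t) (ℕP.<⇒≤ t+2≤n)
      ; length₂ = lengths (suc (suc t)) t+2≤n
      ; curvature = curvatures (suc t) (s≤s z≤n) (ℕP.pred-mono-≤ t+2≤n) }
      where
      t+2≤n : 2 ℕ.+ t ≤ n
      t+2≤n = ℕP.≤-pred (subst (3 ℕ.+ t ≤_) (ℕP.+-comm n 1) t+3≤n+1)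

Window : Set
Window = Point × Point × Point × Point

module _ {n : ℕ} .{{_ : NonZero n}} where

  window : Polygon n → ℕ → Window
  window P j = at P j , at P (suc j) , at P (suc (suc j)) , at P (suc (suc (suc j)))

  at-mod : ∀ P c j → at P (c ℕ.+ j % n) ≡ at P (c ℕ.+ j)
  at-mod P c j = cong P (fromℕ<-cong _ _ mod-eq (ℕDM.m%n<n (c ℕ.+ j % n) n) (ℕDM.m%n<n (c ℕ.+ j) n))
    where
    mod-eq : (c ℕ.+ j % n) % n ≡ (c ℕ.+ j) % n
    mod-eq = trans (ℕDM.%-distribˡ-+ c (j % n) n)
             (trans (cong (λ r → (c % n ℕ.+ r) % n) (ℕDM.m%n%n≡m%n j n)) (sym (ℕDM.%-distribˡ-+ c j n)))

  window-mod : ∀ P j → window P (j % n) ≡ window P j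
  window-mod P j = cong₂ _,_ (at-mod P 0 j) (cong₂ _,_ (at-mod P 1 j) (cong₂ _,_ (at-mod P 2 j) (at-mod P 3 j)))

  periodic : ∀ (Q : Window → Window → Set) P P′ → (∀ i → i < n → Q (window P i) (window P′ i)) →
             ∀ j → Q (window P j) (window P′ j)
  periodic Q P P′ q j = subst₂ Q (window-mod P j) (window-mod P′ j) (q (j % n) (ℕDM.m%n<n j n))

  at-toℕ : ∀ P i → at P (toℕ i) ≡ P i
  at-toℕ P i = cong P (trans (fromℕ<-cong _ _ (ℕDM.m<n⇒m%n≡m (toℕ<n i)) (ℕDM.m%n<n (toℕ i) n) (toℕ<n i)) (fromℕ<-toℕ i (toℕ<n i)))

  LocallyConvexPoly⇒Convex₂ : ∀ P → LocallyConvexPoly n P → ∀ j →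
    Convex₂ (at P j) (at P (suc j)) (at P (suc (suc j))) (at P (suc (suc (suc j))))
  LocallyConvexPoly⇒Convex₂ P (inj₁ positive) j = inj₁ (everywhere j , everywhere (suc j))
    where everywhere = periodic (λ { (A , B , C , _) _ → orient A B C >ℤ 0ℤ }) P P (λ i i<n → positive i i<n)
  LocallyConvexPoly⇒Convex₂ P (inj₂ negative) j = inj₂ (everywhere j , everywhere (suc j))
    where everywhere = periodic (λ { (A , B , C , _) _ → orient A B C <ℤ 0ℤ }) P P (λ i i<n → negative i i<n)

module _ {n : ℕ} .{{_ : NonZero n}} (P P′ : Polygon n) where

  IntCongruentPoly⇒invariants : LocallyConvexPoly n P → IntCongruentPoly n P P′ →
                                SameAngleCurvPoly n P P′ × SameLengthsPoly n P P′
  IntCongruentPoly⇒invariants convexP (g , gP) = (angles , curvatures) , lengths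
    where
    gAt : ∀ k → apply g (at P k) ≡ at P′ k
    gAt k = gP _
    angles : ∀ i → i < n → AngleCong (at P i) (at P (suc i)) (at P (suc (suc i))) (at P′ i) (at P′ (suc i)) (at P′ (suc (suc i)))
    angles i _ = congruent⇒AngleCong g (gAt i) (gAt (suc i)) (gAt (suc (suc i)))
    curvatures : ∀ i → i < n → SameChordCurv (at P i) (at P (suc i)) (at P (suc (suc i))) (at P (suc (suc (suc i))))
                                             (at P′ i) (at P′ (suc i)) (at P′ (suc (suc i))) (at P′ (suc (suc (suc i))))
    curvatures i _ = congruent⇒SameChordCurv g (LocallyConvexPoly⇒Convex₂ P convexP i)
      (gAt i) (gAt (suc i)) (gAt (suc (suc i))) (gAt (suc (suc (suc i))))
    lengths : SameLengthsPoly n P P′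
    lengths i _ = congruent⇒same-intLength g (gAt i) (gAt (suc i))

  invariants⇒IntCongruentPoly : LocallyConvexPoly n P → LocallyConvexPoly n P′ →
                                SameAngleCurvPoly n P P′ × SameLengthsPoly n P P′ → IntCongruentPoly n P P′
  invariants⇒IntCongruentPoly convexP convexP′ ((angles , curvatures) , lengths) = g , λ i →
    trans (cong (apply g) (sym (at-toℕ P i))) (trans (gAt (toℕ i) (toℕ i) ℕP.≤-refl) (at-toℕ P′ i))
    where
    angle : ∀ j → AngleCong (at P j) (at P (suc j)) (at P (suc (suc j))) (at P′ j) (at P′ (suc j)) (at P′ (suc (suc j)))
    angle = periodic (λ { (A , B , C , _) (A′ , B′ , C′ , _) → AngleCong A B C A′ B′ C′ }) P P′ angles
    curvature : ∀ j → SameChordCurv (at P j) (at P (suc j)) (at P (suc (suc j))) (at P (suc (suc (suc j))))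
                                    (at P′ j) (at P′ (suc j)) (at P′ (suc (suc j))) (at P′ (suc (suc (suc j))))
    curvature = periodic (λ { (A , B , C , D) (A′ , B′ , C′ , D′) → SameChordCurv A B C D A′ B′ C′ D′ }) P P′ curvatures
    length : ∀ j → intLength (at P j) (at P (suc j)) ≡ intLength (at P′ j) (at P′ (suc j))
    length = periodic (λ { (A , B , _) (A′ , B′ , _) → intLength A B ≡ intLength A′ B′ }) P P′ lengths
    start = AngleCong⇒congruent (angle 0) (length 0) (length 1)
    g = proj₁ start
    matching : ∀ t → Matching (at P) (at P′) t
    matching t = record
      { convex = LocallyConvexPoly⇒Convex₂ P convexP t
      ; convex′ = LocallyConvexPoly⇒Convex₂ P′ convexP′ t
      ; angle = angle (suc t)
      ; length₁ = length (suc t)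
      ; length₂ = length (suc (suc t))
      ; curvature = curvature t }
    gAt : ∀ N j → j ≤ N → apply g (at P j) ≡ at P′ j
    gAt N = propagate g (at P) (at P′) N (λ t _ → matching t)
      (proj₁ (proj₂ start)) (proj₁ (proj₂ (proj₂ start))) (proj₂ (proj₂ (proj₂ start)))

mainTheorem3 : ((n : ℕ) → 1 ≤ n → (A A' : BrokenLine) →
    LocallyConvexBL n A → LocallyConvexBL n A' →
    (IntCongruentBL n A A' ⇔ (SameAngleCurvBL n A A' × SameLengthsBL n A A')))
    ×
    ((n : ℕ) → .{{_ : NonZero n}} → (P P' : Polygon n) →
    LocallyConvexPoly n P → LocallyConvexPoly n P' →
    (IntCongruentPoly n P P' ⇔ (SameAngleCurvPoly n P P' × SameLengthsPoly n P P')))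
mainTheorem3 =
  (λ n 1≤n A A′ convexA convexA′ →
     mk⇔ (IntCongruentBL⇒invariants n 1≤n A A′ convexA) (invariants⇒IntCongruentBL n 1≤n A A′ convexA convexA′)) ,
  (λ n P P′ convexP convexP′ →
     mk⇔ (IntCongruentPoly⇒invariants P P′ convexP) (invariants⇒IntCongruentPoly P P′ convexP convexP′))
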